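{- Let $p$ be an odd prime, $m\ge1$, $q=p^m$, and let $\gamma\in GF(q^2)$ with $\gamma^2\neq\bar\gamma^2$. There are exactly $2(q-1)$ circles in $\mathbb M(q)$ tangent to both $B^2_{(\gamma,0)}$ and $B^2_{(\bar\gamma,0)}$. They are the circles $B^1_{(c,r)}$ with $c\in GF(q^2)\setminus\{0\}$ and either \[ c=\bar c,\quad r=c^2\frac{(\gamma+\bar\gamma)^2}{4\gamma\bar\gamma} \] or \[ c=-\bar c,\quad r=c^2\frac{(\gamma-\bar\gamma)^2}{4\gamma\bar\gamma}. \]
   Context: $GF(q^2)$ is the quadratic extension of $GF(q)$ and $\bar z:=z^q$. The plane $\mathbb M(q)$ has point set $GF(q^2)\cup\{\infty\}$; its circles are $B^1_{(c,r)}=\{z\in GF(q^2):(z-c)(\bar z-\bar c)=r\}$ ($c\in GF(q^2)$, $r\in GF(q)\setminus\{0\}$; first type) and $B^2_{(c,r)}=\{z\in GF(q^2):\bar c z+c\bar z=r\}\cup\{\infty\}$ ($c\in GF(q^2)\setminus\{0\}$, $r\in GF(q)$; second type). Two distinct circles are tangent if they have exactly one common point. -}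

module Defs where

open import Data.Nat using (ℕ; zero; suc)
open import Data.Fin using (Fin)
open import Data.Maybe using (Maybe; just; nothing)
open import Data.Product using (Σ; ∃; _×_; _,_)
open import Data.Sum using (_⊎_)
open import Data.Unit using (⊤)
open import Data.Empty using (⊥)
open import Data.Vec using (Vec; lookup)
open import Function.Bundles using (_↔_; _⇔_)
open import Relation.Nullary using (¬_)
open import Relation.Binary.PropositionalEquality using (_≡_)
open import Algebra.Core using (Op₁; Op₂)
open import Algebra.Structures using (IsCommutativeRing)

-- A finite field with exactly n elements (equality is propositional).
-- _⁻¹ is total; it is only required to be a multiplicative inverse on
-- nonzero elements.
record FiniteField (n : ℕ) : Set₁ where
  infixl 7 _*_
  infixl 6 _+_ _-_
  infix  8 -_
  field
    Carrier : Set
    _+_ _*_ : Op₂ Carrier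
    -_ : Op₁ Carrier
    0# 1# : Carrier
    _⁻¹ : Op₁ Carrier
    isCommutativeRing : IsCommutativeRing _≡_ _+_ _*_ -_ 0# 1#
    0≢1 : ¬ (0# ≡ 1#)
    ⁻¹-inverse : ∀ x → ¬ (x ≡ 0#) → x * (x ⁻¹) ≡ 1#
    enumeration : Carrier ↔ Fin n

  _-_ : Op₂ Carrier
  x - y = x + (- y)

  _^_ : Carrier → ℕ → Carrier
  x ^ zero = 1#
  x ^ suc k = x * (x ^ k)

module Plane (q : ℕ) (F : FiniteField (q Data.Nat.* q)) where
  open FiniteField F public

  conj : Carrier → Carrier
  conj z = z ^ q

  InGFq : Carrier → Set
  InGFq r = conj r ≡ r

  -- points: GF(q^2) ∪ {∞}, with nothing = ∞
  Point : Set
  Point = Maybe Carrier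

  PointSet : Set₁
  PointSet = Point → Set

  pts¹ : Carrier → Carrier → PointSet
  pts¹ c r nothing = ⊥
  pts¹ c r (just z) = (z - c) * (conj z - conj c) ≡ r

  pts² : Carrier → Carrier → PointSet
  pts² c r nothing = ⊤
  pts² c r (just z) = conj c * z + c * conj z ≡ r

  data Circle : Set where
    B¹ : (c r : Carrier) → InGFq r → ¬ (r ≡ 0#) → Circle
    B² : (c r : Carrier) → ¬ (c ≡ 0#) → InGFq r → Circle

  pts : Circle → PointSet
  pts (B¹ c r _ _) = pts¹ c r
  pts (B² c r _ _) = pts² c r

  _≐_ : PointSet → PointSet → Set
  P ≐ Q = ∀ x → (P x ⇔ Q x)

  Tangent : PointSet → PointSet → Set
  Tangent P Q = ¬ (P ≐ Q) × Σ Point (λ x → (P x × Q x) × (∀ y → P y → Q y → y ≡ x))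

  TangentBoth : Carrier → Circle → Set
  TangentBoth γ C = Tangent (pts C) (pts² γ 0#) × Tangent (pts C) (pts² (conj γ) 0#)

  four : Carrier
  four = 1# + 1# + 1# + 1#

  rPlus : Carrier → Carrier → Carrier
  rPlus γ c = c * c * ((γ + conj γ) * (γ + conj γ)) * (four * γ * conj γ) ⁻¹

  rMinus : Carrier → Carrier → Carrier
  rMinus γ c = c * c * ((γ - conj γ) * (γ - conj γ)) * (four * γ * conj γ) ⁻¹

  GoodParams : Carrier → Carrier → Carrier → Set
  GoodParams γ c r = ¬ (c ≡ 0#) ×
    ((c ≡ conj c × r ≡ rPlus γ c) ⊎ (c ≡ - conj c × r ≡ rMinus γ c))

  ExactlyTangentBoth : Carrier → ℕ → Set
  ExactlyTangentBoth γ N = Σ (Vec Circle N) λ L →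
      (∀ i → TangentBoth γ (lookup L i))
    × (∀ i j → pts (lookup L i) ≐ pts (lookup L j) → i ≡ j)
    × (∀ C → TangentBoth γ C → ∃ λ i → pts C ≐ pts (lookup L i))

module Submission where

-- Conjugation z ↦ z̄ = z ^ q is an involutive automorphism of GF(q²): additivity is the Frobenius
-- identity, and z ^ (q²) = z because multiplication by z ≠ 0 permutes the field. Fix ε = γ - γ̄, so
-- ε̄ = -ε ≠ 0 and GF(q²) = GF(q) ⊕ ε GF(q); in particular |GF(q)| = q.
--
-- For δ ≠ 0 the line B²(δ,0) consists of ∞ and the points s ε δ with s ∈ GF(q). On it, the equation
-- of B¹(c,r) becomes a quadratic in s with coefficients in GF(q) and discriminant ε² Δ(δ,c,r), where
-- Δ(δ,c,r) = (δ c̄ - δ̄ c)² + 4 δ δ̄ (c c̄ - r). As ∞ ∉ B¹(c,r), the circle is tangent to the line iff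
-- the quadratic has a double root, i.e. iff Δ(δ,c,r) = 0, and the point of contact determines
-- δ c̄ - δ̄ c. A circle B²(c,r) tangent to the line shares ∞ with it, so it is parallel (c̄ δ = c δ̄);
-- this cannot hold for both δ = γ and δ = γ̄ since γ² ≠ γ̄².
--
-- Finally Δ(γ,c,r) - Δ(γ̄,c,r) = (γ² - γ̄²)(c̄ + c)(c̄ - c), so tangency to both lines means c̄ = ±c and
-- then r is the stated multiple of c². The two contact points determine c, and there are q - 1
-- admissible centres of each kind (c ∈ GF(q)* or c ∈ ε GF(q)*).

open import Defs
open import Algebra.Bundles using (CommutativeRing)
import Algebra.Properties.CommutativeMonoid.Sum
open import Data.Bool using (Bool; true; false; T)
open import Data.Bool.Properties using (T-irrelevant)
open import Data.Empty using (⊥-elim)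
open import Data.Fin as Fin using (Fin; zero; suc; toℕ; fromℕ)
import Data.Fin.Properties as Fin
open import Data.Fin.Permutation using (Permutation; ↔⇒≡)
open import Data.Integer as ℤ using (ℤ)
import Data.Integer.Properties as ℤ
open import Data.Maybe using (just; nothing)
open import Data.Maybe.Properties using (just-injective)
open import Data.Nat as N using (ℕ; zero; suc; _≤_; _<_; s≤s; z≤n; _∸_; _!)
import Data.Nat.Properties as N
open import Data.Nat.DivMod as N using (m/n*n≡m)
open import Data.Nat.Divisibility using (_∣_; _∤_; ∣⇒≤; ∣1⇒≡1; divides; m∣m*n)
open import Data.Nat.Primality using (Prime; euclidsLemma; prime⇒nonZero; prime⇒nonTrivial; composite-≢)
open import Data.Product using (Σ; ∃; _×_; _,_; proj₁; proj₂)
open import Data.Product.Function.Dependent.Propositional using (Σ-↔)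
open import Data.Product.Function.NonDependent.Propositional using (_×-↔_)
import Data.Sign as Sign
open import Data.Sum using (_⊎_; inj₁; inj₂)
open import Data.Sum.Function.Propositional using (_⊎-↔_)
open import Data.Unit using (⊤; tt)
open import Data.Vec as Vec using (Vec)
import Data.Vec.Properties as Vec
open import Data.Vec.Functional using (removeAt)
open import Function using (_∘_)
open import Function.Bundles using (Injection; Inverse; Equivalence; _↔_; _⇔_; mk⇔; mk↔ₛ′)
open import Function.Construct.Composition using (_↔-∘_)
open import Function.Construct.Identity using (↔-id)
open import Function.Construct.Symmetry using (↔-sym)
open import Function.Properties.Inverse using (↔⇒↣)
open import Relation.Binary.Definitions using (WeaklyDecidable; tri<; tri≈; tri>)
open import Relation.Nullary using (¬_; Dec; yes; no; ¬?)
open import Relation.Nullary.Decidable using (decidable-stable; isYes; True; toWitness; fromWitness; _×-dec_)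
open import Relation.Binary.PropositionalEquality
  using (_≡_; _≢_; refl; sym; trans; cong; cong₂; subst; subst₂; module ≡-Reasoning)

module IntegerRingSolver {a ℓ} (R : CommutativeRing a ℓ) where

  open import Data.Integer using (+_; -[1+_]; _⊖_)
  open CommutativeRing R renaming (refl to ≈-refl; sym to ≈-sym; trans to ≈-trans)
  open import Algebra.Properties.Semiring.Mult.TCOptimised semiring
    using (×-homo-+; ×1-homo-*; 1+×) renaming (_×_ to _×′_)
  open import Algebra.Properties.Ring ring
    using (-‿involutive; -‿distribˡ-*; -‿distribʳ-*; -0#≈0#; -‿+-comm)
  open import Algebra.Properties.CommutativeSemigroup +-commutativeSemigroup using (interchange)
  open import Algebra.Solver.Ring.AlmostCommutativeRing
    using (fromCommutativeRing; _-Raw-AlmostCommutative⟶_)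
  open import Relation.Binary.Reasoning.Setoid setoid

  -- With the type-checking-optimised multiple _×′_, ι (+ 4) reduces to 1# + 1# + 1# + 1#, the
  -- constant four of Defs, so that solve accepts identities stated with it.
  ι : ℤ → Carrier
  ι (+ k) = k ×′ 1#
  ι -[1+ k ] = - (suc k ×′ 1#)

  ι-⊖ : ∀ m n → ι (m ⊖ n) ≈ m ×′ 1# - n ×′ 1#
  ι-⊖ zero zero = ≈-sym (≈-trans (+-identityˡ _) -0#≈0#)
  ι-⊖ zero (suc n) = ≈-sym (+-identityˡ _)
  ι-⊖ (suc m) zero = ≈-sym (≈-trans (+-congˡ -0#≈0#) (+-identityʳ _))
  ι-⊖ (suc m) (suc n) = begin
    ι (suc m ⊖ suc n)                   ≡⟨ cong ι (ℤ.[1+m]⊖[1+n]≡m⊖n m n) ⟩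
    ι (m ⊖ n)                           ≈⟨ ι-⊖ m n ⟩
    m ×′ 1# - n ×′ 1#                   ≈⟨ +-identityˡ _ ⟨
    0# + (m ×′ 1# - n ×′ 1#)            ≈⟨ +-congʳ (-‿inverseʳ 1#) ⟨
    (1# - 1#) + (m ×′ 1# - n ×′ 1#)     ≈⟨ interchange _ _ _ _ ⟩
    (1# + m ×′ 1#) + (- 1# - n ×′ 1#)   ≈⟨ +-congˡ (-‿+-comm _ _) ⟩
    (1# + m ×′ 1#) - (1# + n ×′ 1#)     ≈⟨ +-cong (1+× m 1#) (-‿cong (1+× n 1#)) ⟨
    suc m ×′ 1# - suc n ×′ 1#           ∎

  ι-homo-+ : ∀ i j → ι (i ℤ.+ j) ≈ ι i + ι j
  ι-homo-+ (+ m) (+ n) = ×-homo-+ 1# m n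
  ι-homo-+ (+ m) -[1+ n ] = ι-⊖ m (suc n)
  ι-homo-+ -[1+ m ] (+ n) = ≈-trans (ι-⊖ n (suc m)) (+-comm _ _)
  ι-homo-+ -[1+ m ] -[1+ n ] = begin
    - (suc (suc (m N.+ n)) ×′ 1#)       ≡⟨ cong (λ k → - (suc k ×′ 1#)) (N.+-suc m n) ⟨
    - ((suc m N.+ suc n) ×′ 1#)         ≈⟨ -‿cong (×-homo-+ 1# (suc m) (suc n)) ⟩
    - (suc m ×′ 1# + suc n ×′ 1#)       ≈⟨ -‿+-comm _ _ ⟨
    - (suc m ×′ 1#) + - (suc n ×′ 1#)   ∎

  ι-homo-neg : ∀ i → ι (ℤ.- i) ≈ - ι i
  ι-homo-neg (+ zero) = ≈-sym -0#≈0#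
  ι-homo-neg (+ suc n) = ≈-refl
  ι-homo-neg -[1+ n ] = ≈-sym (-‿involutive _)

  ι-+◃ : ∀ k → ι (Sign.+ ℤ.◃ k) ≈ k ×′ 1#
  ι-+◃ zero = ≈-refl
  ι-+◃ (suc k) = ≈-refl

  ι--◃ : ∀ k → ι (Sign.- ℤ.◃ k) ≈ - (k ×′ 1#)
  ι--◃ zero = ≈-sym -0#≈0#
  ι--◃ (suc k) = ≈-refl

  ι-homo-* : ∀ i j → ι (i ℤ.* j) ≈ ι i * ι j
  ι-homo-* (+ m) (+ n) = ≈-trans (ι-+◃ (m N.* n)) (×1-homo-* m n)
  ι-homo-* (+ m) -[1+ n ] =
    ≈-trans (ι--◃ (m N.* suc n)) (≈-trans (-‿cong (×1-homo-* m (suc n))) (-‿distribʳ-* _ _))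
  ι-homo-* -[1+ m ] (+ n) =
    ≈-trans (ι--◃ (suc m N.* n)) (≈-trans (-‿cong (×1-homo-* (suc m) n)) (-‿distribˡ-* _ _))
  ι-homo-* -[1+ m ] -[1+ n ] = begin
    (suc m N.* suc n) ×′ 1#             ≈⟨ ×1-homo-* (suc m) (suc n) ⟩
    suc m ×′ 1# * suc n ×′ 1#           ≈⟨ -‿involutive _ ⟨
    - - (suc m ×′ 1# * suc n ×′ 1#)     ≈⟨ -‿cong (-‿distribˡ-* _ _) ⟩
    - (- (suc m ×′ 1#) * suc n ×′ 1#)   ≈⟨ -‿distribʳ-* _ _ ⟩
    - (suc m ×′ 1#) * - (suc n ×′ 1#)   ∎

  ι-morphism : CommutativeRing.rawRing ℤ.+-*-commutativeRing -Raw-AlmostCommutative⟶ fromCommutativeRing R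
  ι-morphism = record
    { ⟦_⟧ = ι ; +-homo = ι-homo-+ ; *-homo = ι-homo-* ; -‿homo = ι-homo-neg
    ; 0-homo = ≈-refl ; 1-homo = ≈-refl }

  ι-equal? : WeaklyDecidable (λ i j → ι i ≈ ι j)
  ι-equal? i j with i ℤ.≟ j
  ... | yes refl = just ≈-refl
  ... | no _ = nothing

  open import Algebra.Solver.Ring _ (fromCommutativeRing R) ι-morphism ι-equal? public
    using (Polynomial; solve; _:+_; _:*_; _:-_; :-_; _:=_; con)

  infix 9 #_
  #_ : ∀ {m} → ℕ → Polynomial m
  # k = con (+ k)

module FiniteCounting where

  Σ-T-≡ : ∀ {A : Set} (P : A → Bool) {x y : A} {s : T (P x)} {t : T (P y)} →
          x ≡ y → _≡_ {A = Σ A (T ∘ P)} (x , s) (y , t)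
  Σ-T-≡ P {x} {s = s} {t} refl = cong (x ,_) (T-irrelevant s t)

  countFin : ∀ {k} (P : Fin k → Bool) → ∃ λ ℓ → Fin ℓ ↔ Σ (Fin k) (T ∘ P)
  countFin {zero} P = 0 , mk↔ₛ′ (λ ()) (λ ()) (λ ()) (λ ())
  countFin {suc k} P with countFin (P ∘ suc) | P zero in P0
  ... | ℓ , e | true = suc ℓ , mk↔ₛ′ to from to-from from-to
    where
      module E = Inverse e
      to : Fin (suc ℓ) → Σ (Fin (suc k)) (T ∘ P)
      to zero = zero , subst T (sym P0) _
      to (suc j) = suc (proj₁ (E.to j)) , proj₂ (E.to j)
      from : Σ (Fin (suc k)) (T ∘ P) → Fin (suc ℓ)
      from (zero , _) = zero
      from (suc i , t) = suc (E.from (i , t))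
      to-from : ∀ y → to (from y) ≡ y
      to-from (zero , t) = Σ-T-≡ P refl
      to-from (suc i , t) = Σ-T-≡ P (cong (suc ∘ proj₁) (E.strictlyInverseˡ (i , t)))
      from-to : ∀ x → from (to x) ≡ x
      from-to zero = refl
      from-to (suc j) = cong suc (E.strictlyInverseʳ j)
  ... | ℓ , e | false = ℓ , mk↔ₛ′ to from to-from E.strictlyInverseʳ
    where
      module E = Inverse e
      to : Fin ℓ → Σ (Fin (suc k)) (T ∘ P)
      to j = suc (proj₁ (E.to j)) , proj₂ (E.to j)
      from : Σ (Fin (suc k)) (T ∘ P) → Fin ℓ
      from (zero , t) = ⊥-elim (subst T P0 t)
      from (suc i , t) = E.from (i , t)
      to-from : ∀ y → to (from y) ≡ y
      to-from (zero , t) = ⊥-elim (subst T P0 t)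
      to-from (suc i , t) = Σ-T-≡ P (cong (suc ∘ proj₁) (E.strictlyInverseˡ (i , t)))

  count : ∀ {A : Set} {k} → A ↔ Fin k → (P : A → Bool) → ∃ λ ℓ → Fin ℓ ↔ Σ A (T ∘ P)
  count e P with countFin (P ∘ Inverse.from e)
  ... | ℓ , c = ℓ , Σ-↔ (↔-sym e) (↔-id _) ↔-∘ c

  m*m≡n*n⇒m≡n : ∀ {m n} → m N.* m ≡ n N.* n → m ≡ n
  m*m≡n*n⇒m≡n {m} {n} m²≡n² with N.<-cmp m n
  ... | tri< m<n _ _ = ⊥-elim (N.<-irrefl m²≡n² (N.*-mono-< m<n m<n))
  ... | tri≈ _ m≡n _ = m≡n
  ... | tri> _ _ n<m = ⊥-elim (N.<-irrefl (sym m²≡n²) (N.*-mono-< n<m n<m))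

module PrimeBinomial (p : ℕ) (p-prime : Prime p) where

  open import Data.Nat.Combinatorics using (_C_; nCk≡n!/k![n-k]!; k![n∸k]!∣n!)

  instance
    p≢0 : N.NonZero p
    p≢0 = prime⇒nonZero p-prime

  1<p : 1 < p
  1<p = N.nonTrivial⇒n>1 p {{prime⇒nonTrivial p-prime}}

  p∤j! : ∀ j → j < p → p ∤ j !
  p∤j! zero _ p∣1 = N.<⇒≢ 1<p (sym (∣1⇒≡1 p∣1))
  p∤j! (suc j) j<p p∣j! with euclidsLemma (suc j) (j !) p-prime p∣j!
  ... | inj₁ p∣1+j = N.<⇒≱ j<p (∣⇒≤ p∣1+j)
  ... | inj₂ p∣j! = p∤j! j (N.<-trans (N.n<1+n j) j<p) p∣j!

  n∣n! : ∀ n .{{_ : N.NonZero n}} → n ∣ n !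
  n∣n! (suc k) = m∣m*n (k !)

  p∣pCk : ∀ k → 0 < k → k < p → p ∣ p C k
  p∣pCk k 0<k k<p with euclidsLemma (p C k) D p-prime p∣pCk*D
    where
      k≤p = N.<⇒≤ k<p
      D = k ! N.* (p ∸ k) !
      instance
        D≢0 : N.NonZero D
        D≢0 = k N.!* (p ∸ k) !≢0
      pCk*D≡p! : (p C k) N.* D ≡ p !
      pCk*D≡p! = trans (cong (N._* D) (nCk≡n!/k![n-k]! k≤p)) (m/n*n≡m (k![n∸k]!∣n! k≤p))
      p∣pCk*D : p ∣ (p C k) N.* D
      p∣pCk*D = subst (p ∣_) (sym pCk*D≡p!) (n∣n! p)
  ... | inj₁ p∣pCk = p∣pCk
  ... | inj₂ p∣D with euclidsLemma (k !) ((p ∸ k) !) p-prime p∣D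
  ...   | inj₁ p∣k! = ⊥-elim (p∤j! k k<p p∣k!)
  ...   | inj₂ p∣[p-k]! = ⊥-elim (p∤j! (p ∸ k) (N.∸-monoʳ-< 0<k (N.<⇒≤ k<p)) p∣[p-k]!)

module FieldProperties {n} (F : FiniteField n) where
  open FiniteField F

  commutativeRing : CommutativeRing _ _
  commutativeRing = record { isCommutativeRing = isCommutativeRing }

  open CommutativeRing commutativeRing public
    using ( +-assoc; +-comm; *-assoc; *-comm; +-identityˡ; +-identityʳ; *-identityˡ; *-identityʳ
          ; distribʳ; -‿inverseˡ; semiring; -‿inverseʳ; zeroˡ; zeroʳ; ring; +-commutativeMonoid; *-commutativeMonoid)
  open import Algebra.Properties.Ring ring public
    using ( -‿involutive; -‿injective; -‿distribˡ-*; -‿distribʳ-*; -0#≈0#; -‿+-comm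
          ; x∙y⁻¹≈ε⇒x≈y; x≈y⇒x∙y⁻¹≈ε; +-inverseˡ-unique; +-cancelˡ)
  open IntegerRingSolver commutativeRing public
    using (solve; _:+_; _:*_; _:-_; :-_; _:=_; #_)
  open import Algebra.Properties.Semiring.Mult.TCOptimised semiring public
    using (×ᵤ≈×; ×-homo-+; ×1-homo-*; 1+×) renaming (_×_ to _×′_)

  infix 4 _≟_
  _≟_ : (x y : Carrier) → Dec (x ≡ y)
  _≟_ = Fin.inj⇒≟ (↔⇒↣ enumeration)

  x⁻¹*x≡1 : ∀ {x} → x ≢ 0# → x ⁻¹ * x ≡ 1#
  x⁻¹*x≡1 {x} x≢0 = trans (*-comm _ _) (⁻¹-inverse x x≢0)

  x≢0⇒x*y≡0⇒y≡0 : ∀ {x y} → x ≢ 0# → x * y ≡ 0# → y ≡ 0#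
  x≢0⇒x*y≡0⇒y≡0 {x} {y} x≢0 xy≡0 = begin
    y                ≡⟨ *-identityˡ y ⟨
    1# * y           ≡⟨ cong (_* y) (x⁻¹*x≡1 x≢0) ⟨
    x ⁻¹ * x * y     ≡⟨ *-assoc _ _ _ ⟩
    x ⁻¹ * (x * y)   ≡⟨ cong (x ⁻¹ *_) xy≡0 ⟩
    x ⁻¹ * 0#        ≡⟨ zeroʳ _ ⟩
    0#               ∎
    where open ≡-Reasoning

  x*y≡0⇒x≡0∨y≡0 : ∀ x y → x * y ≡ 0# → x ≡ 0# ⊎ y ≡ 0#
  x*y≡0⇒x≡0∨y≡0 x y xy≡0 with x ≟ 0#
  ... | yes x≡0 = inj₁ x≡0
  ... | no x≢0 = inj₂ (x≢0⇒x*y≡0⇒y≡0 x≢0 xy≡0)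

  x*x≡0⇒x≡0 : ∀ {x} → x * x ≡ 0# → x ≡ 0#
  x*x≡0⇒x≡0 {x} xx≡0 with x ≟ 0#
  ... | yes x≡0 = x≡0
  ... | no x≢0 = x≢0⇒x*y≡0⇒y≡0 x≢0 xx≡0

  *-≢0 : ∀ {x y} → x ≢ 0# → y ≢ 0# → x * y ≢ 0#
  *-≢0 x≢0 y≢0 xy≡0 = y≢0 (x≢0⇒x*y≡0⇒y≡0 x≢0 xy≡0)

  *-cancelˡ : ∀ {x y z} → x ≢ 0# → x * y ≡ x * z → y ≡ z
  *-cancelˡ {x} {y} {z} x≢0 xy≡xz = x∙y⁻¹≈ε⇒x≈y y z (x≢0⇒x*y≡0⇒y≡0 x≢0 (begin
    x * (y - z)      ≡⟨ solve 3 (λ x y z → x :* (y :- z) := x :* y :- x :* z) refl x y z ⟩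
    x * y - x * z    ≡⟨ x≈y⇒x∙y⁻¹≈ε xy≡xz ⟩
    0#               ∎))
    where open ≡-Reasoning

  *-cancelʳ : ∀ {x y z} → x ≢ 0# → y * x ≡ z * x → y ≡ z
  *-cancelʳ {x} {y} {z} x≢0 yx≡zx = *-cancelˡ x≢0 (trans (*-comm x y) (trans yx≡zx (*-comm z x)))

  ⁻¹-≢0 : ∀ {x} → x ≢ 0# → x ⁻¹ ≢ 0#
  ⁻¹-≢0 {x} x≢0 x⁻¹≡0 = 0≢1 (trans (sym (zeroʳ x)) (trans (cong (x *_) (sym x⁻¹≡0)) (⁻¹-inverse x x≢0)))

  -‿≢0 : ∀ {x} → x ≢ 0# → - x ≢ 0#
  -‿≢0 {x} x≢0 -x≡0 = x≢0 (trans (sym (-‿involutive x)) (trans (cong -_ -x≡0) -0#≈0#))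

  -‿⁻¹ : ∀ {x} → x ≢ 0# → (- x) ⁻¹ ≡ - x ⁻¹
  -‿⁻¹ {x} x≢0 = *-cancelˡ (-‿≢0 x≢0) (begin
    - x * (- x) ⁻¹   ≡⟨ ⁻¹-inverse (- x) (-‿≢0 x≢0) ⟩
    1#               ≡⟨ ⁻¹-inverse x x≢0 ⟨
    x * x ⁻¹         ≡⟨ solve 2 (λ x u → x :* u := :- x :* :- u) refl x (x ⁻¹) ⟩
    - x * - x ⁻¹     ∎)
    where open ≡-Reasoning

  x*[y*x⁻¹]≡y : ∀ {x} y → x ≢ 0# → x * (y * x ⁻¹) ≡ y
  x*[y*x⁻¹]≡y {x} y x≢0 = begin
      x * (y * x ⁻¹)   ≡⟨ solve 3 (λ x y u → x :* (y :* u) := y :* (x :* u)) refl x y (x ⁻¹) ⟩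
      y * (x * x ⁻¹)   ≡⟨ cong (y *_) (⁻¹-inverse x x≢0) ⟩
      y * 1#           ≡⟨ *-identityʳ y ⟩
      y                ∎
    where open ≡-Reasoning

  x*y≡z⇒y≡z*x⁻¹ : ∀ {x y z} → x ≢ 0# → x * y ≡ z → y ≡ z * x ⁻¹
  x*y≡z⇒y≡z*x⁻¹ {z = z} x≢0 xy≡z = *-cancelˡ x≢0 (trans xy≡z (sym (x*[y*x⁻¹]≡y z x≢0)))

  y-x*z≡0⇔z≡y*x⁻¹ : ∀ {x y z} → x ≢ 0# → (y - x * z ≡ 0#) ⇔ (z ≡ y * x ⁻¹)
  y-x*z≡0⇔z≡y*x⁻¹ {x} {y} {z} x≢0 = mk⇔
    (λ y-xz≡0 → x*y≡z⇒y≡z*x⁻¹ x≢0 (sym (x∙y⁻¹≈ε⇒x≈y _ _ y-xz≡0)))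
    (λ z≡y/x → x≈y⇒x∙y⁻¹≈ε (sym (trans (cong (x *_) z≡y/x) (x*[y*x⁻¹]≡y y x≢0))))

  x≡-x⇒x≡0 : 2 ×′ 1# ≢ 0# → ∀ {x} → x ≡ - x → x ≡ 0#
  x≡-x⇒x≡0 2≢0 {x} x≡-x = x≢0⇒x*y≡0⇒y≡0 2≢0 (begin
      2 ×′ 1# * x    ≡⟨ solve 1 (λ x → # 2 :* x := x :+ x) refl x ⟩
      x + x          ≡⟨ cong (x +_) x≡-x ⟩
      x - x          ≡⟨ -‿inverseʳ x ⟩
      0#             ∎)
    where open ≡-Reasoning

  ^-distribˡ-+-* : ∀ x a b → x ^ (a N.+ b) ≡ x ^ a * x ^ b
  ^-distribˡ-+-* x zero b = sym (*-identityˡ _)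
  ^-distribˡ-+-* x (suc a) b = trans (cong (x *_) (^-distribˡ-+-* x a b)) (sym (*-assoc _ _ _))

  ^-*-assoc : ∀ x a b → (x ^ b) ^ a ≡ x ^ (a N.* b)
  ^-*-assoc x zero b = refl
  ^-*-assoc x (suc a) b = trans (cong (x ^ b *_) (^-*-assoc x a b)) (sym (^-distribˡ-+-* x b (a N.* b)))

  ^-distribʳ-* : ∀ x y k → (x * y) ^ k ≡ x ^ k * y ^ k
  ^-distribʳ-* x y zero = sym (*-identityˡ _)
  ^-distribʳ-* x y (suc k) = trans (cong (x * y *_) (^-distribʳ-* x y k))
    (solve 4 (λ x y a b → x :* y :* (a :* b) := x :* a :* (y :* b)) refl x y (x ^ k) (y ^ k))

  1^k≡1 : ∀ k → 1# ^ k ≡ 1#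
  1^k≡1 zero = refl
  1^k≡1 (suc k) = trans (*-identityˡ _) (1^k≡1 k)

  ^-≢0 : ∀ {x} k → x ≢ 0# → x ^ k ≢ 0#
  ^-≢0 zero x≢0 1≡0 = 0≢1 (sym 1≡0)
  ^-≢0 (suc k) x≢0 = *-≢0 x≢0 (^-≢0 k x≢0)

  x^k≡0⇒x≡0 : ∀ {x} k → x ^ k ≡ 0# → x ≡ 0#
  x^k≡0⇒x≡0 {x} k xᵏ≡0 with x ≟ 0#
  ... | yes x≡0 = x≡0
  ... | no x≢0 = ⊥-elim (^-≢0 k x≢0 xᵏ≡0)

  0^k≡0 : ∀ k .{{_ : N.NonZero k}} → 0# ^ k ≡ 0#
  0^k≡0 (suc k) = zeroˡ _

  ×′1-homo-^ : ∀ a k → (a N.^ k) ×′ 1# ≡ (a ×′ 1#) ^ k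
  ×′1-homo-^ a zero = refl
  ×′1-homo-^ a (suc k) = trans (×1-homo-* a (a N.^ k)) (cong (a ×′ 1# *_) (×′1-homo-^ a k))

  element : Fin n → Carrier
  element = Inverse.from enumeration

  position : Carrier → Fin n
  position = Inverse.to enumeration

  element-position : ∀ x → element (position x) ≡ x
  element-position = Inverse.strictlyInverseʳ enumeration

  position-element : ∀ i → position (element i) ≡ i
  position-element = Inverse.strictlyInverseˡ enumeration

  permutationOf : Carrier ↔ Carrier → Permutation n n
  permutationOf σ = enumeration ↔-∘ (σ ↔-∘ ↔-sym enumeration)

  translation : Carrier → Carrier ↔ Carrier
  translation a = mk↔ₛ′ (_+ a) (_- a)
    (λ x → solve 2 (λ x a → x :- a :+ a := x) refl x a) (λ x → solve 2 (λ x a → x :+ a :- a := x) refl x a)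

  dilation : ∀ {a} → a ≢ 0# → Carrier ↔ Carrier
  dilation {a} a≢0 = mk↔ₛ′ (a *_) (a ⁻¹ *_)
    (λ y → trans (sym (*-assoc _ _ _)) (trans (cong (_* y) (⁻¹-inverse a a≢0)) (*-identityˡ y)))
    (λ y → trans (sym (*-assoc _ _ _)) (trans (cong (_* y) (x⁻¹*x≡1 a≢0)) (*-identityˡ y)))

  module Σ+ = Algebra.Properties.CommutativeMonoid.Sum +-commutativeMonoid
  module Π* = Algebra.Properties.CommutativeMonoid.Sum *-commutativeMonoid

  -- Summing all elements before and after translating them by 1#.
  card×1≡0 : n ×′ 1# ≡ 0#
  card×1≡0 = sym (+-cancelˡ S _ _ (begin
    S + 0#                                   ≡⟨ +-identityʳ S ⟩
    S                                        ≡⟨ Σ+.sum-permute element (permutationOf (translation 1#)) ⟩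
    Σ+.sum (λ i → element (position (element i + 1#))) ≡⟨ Σ+.sum-cong-≗ (λ i → element-position (element i + 1#)) ⟩
    Σ+.sum (λ i → element i + 1#)            ≡⟨ Σ+.∑-distrib-+ element (λ _ → 1#) ⟩
    S + Σ+.sum {n} (λ _ → 1#)                ≡⟨ cong (S +_) (trans (Σ+.sum-replicate n) (×ᵤ≈× n 1#)) ⟩
    S + n ×′ 1#                              ∎))
    where
      open ≡-Reasoning
      S = Σ+.sum element

  Π-const : ∀ k x → Π*.sum {k} (λ _ → x) ≡ x ^ k
  Π-const zero x = refl
  Π-const (suc k) x = cong (x *_) (Π-const k x)

  Π-≢0 : ∀ {k} (f : Fin k → Carrier) → (∀ i → f i ≢ 0#) → Π*.sum f ≢ 0#
  Π-≢0 {zero} f f≢0 1≡0 = 0≢1 (sym 1≡0)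
  Π-≢0 {suc k} f f≢0 = *-≢0 (f≢0 zero) (Π-≢0 (f ∘ suc) (f≢0 ∘ suc))

  Π-delta : ∀ {k} (f : Fin k → Carrier) i₀ → (∀ i → i ≢ i₀ → f i ≡ 1#) → Π*.sum f ≡ f i₀
  Π-delta {suc k} f i₀ f≡1 = begin
    Π*.sum f                          ≡⟨ Π*.sum-remove f ⟩
    f i₀ * Π*.sum (removeAt f i₀)     ≡⟨ cong (f i₀ *_) (Π*.sum-cong-≗ (λ j → f≡1 _ (Fin.punchInᵢ≢i i₀ j))) ⟩
    f i₀ * Π*.sum {k} (λ _ → 1#)      ≡⟨ cong (f i₀ *_) (trans (Π-const k 1#) (1^k≡1 k)) ⟩
    f i₀ * 1#                         ≡⟨ *-identityʳ _ ⟩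
    f i₀                              ∎
    where open ≡-Reasoning

  zeroToOne : Carrier → Carrier
  zeroToOne y with y ≟ 0#
  ... | yes _ = 1#
  ... | no _ = y

  zeroToOne-≢0 : ∀ y → zeroToOne y ≢ 0#
  zeroToOne-≢0 y with y ≟ 0#
  ... | yes _ = λ 1≡0 → 0≢1 (sym 1≡0)
  ... | no y≢0 = y≢0

  defect : Carrier → Carrier → Carrier
  defect a y with y ≟ 0#
  ... | yes _ = a
  ... | no _ = 1#

  zeroToOne-* : ∀ {a} → a ≢ 0# → ∀ y → zeroToOne (a * y) * defect a y ≡ a * zeroToOne y
  zeroToOne-* {a} a≢0 y with y ≟ 0# | a * y ≟ 0#
  ... | yes _ | yes _ = trans (*-identityˡ a) (sym (*-identityʳ a))
  ... | yes y≡0 | no ay≢0 = ⊥-elim (ay≢0 (trans (cong (a *_) y≡0) (zeroʳ a)))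
  ... | no y≢0 | yes ay≡0 = ⊥-elim (*-≢0 a≢0 y≢0 ay≡0)
  ... | no _ | no _ = *-identityʳ _

  defect-0 : ∀ a → defect a 0# ≡ a
  defect-0 a with 0# ≟ 0#
  ... | yes _ = refl
  ... | no 0≢0 = ⊥-elim (0≢0 refl)

  defect-≢0 : ∀ a {y} → y ≢ 0# → defect a y ≡ 1#
  defect-≢0 a {y} y≢0 with y ≟ 0#
  ... | yes y≡0 = ⊥-elim (y≢0 y≡0)
  ... | no _ = refl

  Π-defect : ∀ a → Π*.sum (defect a ∘ element) ≡ a
  Π-defect a = trans (Π-delta _ (position 0#) other≡1) (trans (cong (defect a) (element-position 0#)) (defect-0 a))
    where
      other≡1 : ∀ i → i ≢ position 0# → defect a (element i) ≡ 1#
      other≡1 i i≢i₀ = defect-≢0 a (λ eᵢ≡0 → i≢i₀ (trans (sym (position-element i)) (cong position eᵢ≡0)))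

  -- Multiplying every element by x ≢ 0 permutes them; comparing the products of zeroToOne gives xⁿ = x.
  x^card≡x : ∀ x → x ^ n ≡ x
  x^card≡x x with x ≟ 0#
  ... | yes refl = 0^k≡0 n {{Fin.nonZeroIndex (position 0#)}}
  ... | no x≢0 = sym (*-cancelˡ (Π-≢0 G (zeroToOne-≢0 ∘ element)) (begin
    P * x                                        ≡⟨ cong₂ _*_ permuted (sym (Π-defect x)) ⟩
    Π*.sum (λ i → zeroToOne (x * element i)) * Π*.sum (defect x ∘ element)
                                                 ≡⟨ Π*.∑-distrib-+ (λ i → zeroToOne (x * element i)) (defect x ∘ element) ⟨
    Π*.sum (λ i → zeroToOne (x * element i) * defect x (element i))
                                                 ≡⟨ Π*.sum-cong-≗ (zeroToOne-* x≢0 ∘ element) ⟩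
    Π*.sum (λ i → x * G i)                       ≡⟨ Π*.∑-distrib-+ (λ _ → x) G ⟩
    Π*.sum {n} (λ _ → x) * P                     ≡⟨ cong (_* P) (Π-const n x) ⟩
    x ^ n * P                                    ≡⟨ *-comm _ _ ⟩
    P * x ^ n                                    ∎))
    where
      open ≡-Reasoning
      G : Fin n → Carrier
      G = zeroToOne ∘ element
      P = Π*.sum G
      permuted : P ≡ Π*.sum (λ i → zeroToOne (x * element i))
      permuted = trans (Π*.sum-permute G (permutationOf (dilation x≢0)))
                       (Π*.sum-cong-≗ (λ i → cong zeroToOne (element-position (x * element i))))

  module Quadratic (a b d : Carrier) (a≢0 : a ≢ 0#) where

    Q : Carrier → Carrier
    Q s = a * s * s + b * s + d

    discriminant : Carrier
    discriminant = b * b - 4 ×′ 1# * a * d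

    completingSquare : ∀ s →
      discriminant ≡ (b + 2 ×′ 1# * a * s) * (b + 2 ×′ 1# * a * s) - 4 ×′ 1# * a * Q s
    completingSquare = solve 4 (λ a b d s →
      b :* b :- # 4 :* a :* d
        := (b :+ # 2 :* a :* s) :* (b :+ # 2 :* a :* s) :- # 4 :* a :* (a :* s :* s :+ b :* s :+ d)) refl a b d

    otherRoot : Carrier → Carrier
    otherRoot s = - (b * a ⁻¹) - s

    a*[b/a]-b≡0 : a * (b * a ⁻¹) - b ≡ 0#
    a*[b/a]-b≡0 = x≈y⇒x∙y⁻¹≈ε (x*[y*x⁻¹]≡y b a≢0)

    Q-otherRoot : ∀ s → Q s ≡ 0# → Q (otherRoot s) ≡ 0#
    Q-otherRoot s Qs≡0 = begin
      Q (- t - s)                          ≡⟨ solve 5 (λ a b d s t →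
        a :* (:- t :- s) :* (:- t :- s) :+ b :* (:- t :- s) :+ d
          := (a :* s :* s :+ b :* s :+ d) :+ (a :* t :- b) :* (t :+ # 2 :* s)) refl a b d s t ⟩
      Q s + (a * t - b) * (t + 2 ×′ 1# * s) ≡⟨ cong₂ (λ u v → u + v * (t + 2 ×′ 1# * s)) Qs≡0 a*[b/a]-b≡0 ⟩
      0# + 0# * (t + 2 ×′ 1# * s)           ≡⟨ trans (+-identityˡ _) (zeroˡ _) ⟩
      0#                                    ∎
      where
        open ≡-Reasoning
        t = b * a ⁻¹

    otherRoot≡s⇒discriminant≡0 : ∀ s → Q s ≡ 0# → otherRoot s ≡ s → discriminant ≡ 0#
    otherRoot≡s⇒discriminant≡0 s Qs≡0 s′≡s = begin
      discriminant                         ≡⟨ completingSquare s ⟩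
      L * L - 4 ×′ 1# * a * Q s            ≡⟨ cong₂ (λ u v → u * u - 4 ×′ 1# * a * v) L≡0 Qs≡0 ⟩
      0# * 0# - 4 ×′ 1# * a * 0#           ≡⟨ solve 1 (λ a → # 0 :* # 0 :- # 4 :* a :* # 0 := # 0) refl a ⟩
      0#                                   ∎
      where
        open ≡-Reasoning
        t = b * a ⁻¹
        L = b + 2 ×′ 1# * a * s
        L≡0 : L ≡ 0#
        L≡0 = begin
          L                               ≡⟨ solve 4 (λ a b s t →
            b :+ # 2 :* a :* s := :- a :* ((:- t :- s) :- s) :- (a :* t :- b)) refl a b s t ⟩
          - a * (otherRoot s - s) - (a * t - b) ≡⟨ cong₂ (λ u v → - a * u - v) (x≈y⇒x∙y⁻¹≈ε s′≡s) a*[b/a]-b≡0 ⟩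
          - a * 0# - 0#                   ≡⟨ solve 1 (λ a → :- a :* # 0 :- # 0 := # 0) refl a ⟩
          0#                              ∎

    module Vertex (2≢0 : 2 ×′ 1# ≢ 0#) where

      2a≢0 : 2 ×′ 1# * a ≢ 0#
      2a≢0 = *-≢0 2≢0 a≢0

      4a≢0 : 4 ×′ 1# * a ≢ 0#
      4a≢0 = *-≢0 (*-≢0 2≢0 2≢0 ∘ trans (sym (×1-homo-* 2 2))) a≢0

      vertex : Carrier
      vertex = - (b * (2 ×′ 1# * a) ⁻¹)

      b+2a·vertex≡0 : b + 2 ×′ 1# * a * vertex ≡ 0#
      b+2a·vertex≡0 = begin
        b + 2 ×′ 1# * a * - (b * (2 ×′ 1# * a) ⁻¹)
          ≡⟨ solve 3 (λ b a′ u → b :+ a′ :* :- (b :* u) := b :- a′ :* (b :* u)) refl b (2 ×′ 1# * a) ((2 ×′ 1# * a) ⁻¹) ⟩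
        b - 2 ×′ 1# * a * (b * (2 ×′ 1# * a) ⁻¹)  ≡⟨ x≈y⇒x∙y⁻¹≈ε (sym (x*[y*x⁻¹]≡y b 2a≢0)) ⟩
        0#                                        ∎
        where open ≡-Reasoning

      discriminant≡0⇒Q-vertex≡0 : discriminant ≡ 0# → Q vertex ≡ 0#
      discriminant≡0⇒Q-vertex≡0 disc≡0 = x≢0⇒x*y≡0⇒y≡0 4a≢0 (begin
        4 ×′ 1# * a * Q vertex          ≡⟨ solve 2 (λ L X → X := L :* L :- (L :* L :- X)) refl L (4 ×′ 1# * a * Q vertex) ⟩
        L * L - (L * L - 4 ×′ 1# * a * Q vertex) ≡⟨ cong (λ v → L * L - v) (completingSquare vertex) ⟨
        L * L - discriminant            ≡⟨ cong₂ (λ u v → u * u - v) b+2a·vertex≡0 disc≡0 ⟩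
        0# * 0# - 0#                    ≡⟨ solve 0 (# 0 :* # 0 :- # 0 := # 0) refl ⟩
        0#                              ∎)
        where
          open ≡-Reasoning
          L = b + 2 ×′ 1# * a * vertex

      discriminant≡0⇒root≡vertex : ∀ {s} → discriminant ≡ 0# → Q s ≡ 0# → s ≡ vertex
      discriminant≡0⇒root≡vertex {s} disc≡0 Qs≡0 = *-cancelˡ 2a≢0 (+-cancelˡ b _ _ (trans L≡0 (sym b+2a·vertex≡0)))
        where
          open ≡-Reasoning
          L = b + 2 ×′ 1# * a * s
          L≡0 : b + 2 ×′ 1# * a * s ≡ 0#
          L≡0 = x*x≡0⇒x≡0 (begin
            L * L                                   ≡⟨ solve 2 (λ L X → L :* L := (L :* L :- X) :+ X) refl L (4 ×′ 1# * a * Q s) ⟩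
            (L * L - 4 ×′ 1# * a * Q s) + 4 ×′ 1# * a * Q s ≡⟨ cong₂ _+_ (completingSquare s) (cong (4 ×′ 1# * a *_) (sym Qs≡0)) ⟨
            discriminant + 4 ×′ 1# * a * 0#         ≡⟨ cong₂ _+_ disc≡0 (zeroʳ _) ⟩
            0# + 0#                                 ≡⟨ +-identityˡ 0# ⟩
            0#                                      ∎)

  sum-endpoints : ∀ k (h : Fin (suc (suc k)) → Carrier) →
    (∀ i → 0 < toℕ i → toℕ i < suc k → h i ≡ 0#) → Σ+.sum h ≡ h zero + h (fromℕ (suc k))
  sum-endpoints k h inner≡0 = cong (h zero +_) (begin
    Σ+.sum (h ∘ suc)                          ≡⟨ Σ+.sum-init-last (h ∘ suc) ⟩
    Σ+.sum (h ∘ suc ∘ Fin.inject₁) + h (fromℕ (suc k))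
                                              ≡⟨ cong (_+ h (fromℕ (suc k))) (Σ+.sum-cong-≗ inner≡0′) ⟩
    Σ+.sum {k} (λ _ → 0#) + h (fromℕ (suc k)) ≡⟨ cong (_+ h (fromℕ (suc k))) (Σ+.sum-replicate-zero k) ⟩
    0# + h (fromℕ (suc k))                    ≡⟨ +-identityˡ _ ⟩
    h (fromℕ (suc k))                         ∎)
    where
      open ≡-Reasoning
      inner≡0′ : ∀ j → h (suc (Fin.inject₁ j)) ≡ 0#
      inner≡0′ j = inner≡0 _ (s≤s z≤n) (s≤s (Fin.inject₁ℕ< j))

  module Frobenius (p : ℕ) (p-prime : Prime p) (p×1≡0 : p ×′ 1# ≡ 0#) where
    open PrimeBinomial p p-prime
    open import Data.Nat.Combinatorics using (_C_; nCn≡1)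
    open import Algebra.Properties.CommutativeSemiring.Binomial (CommutativeRing.commutativeSemiring commutativeRing)
      using (theorem)
    open import Algebra.Properties.Semiring.Exp semiring using () renaming (_^_ to _^ₛ_)
    open import Algebra.Properties.Semiring.Mult semiring using (×-assoc-*) renaming (_×_ to _×ₛ_; ×1-homo-* to ×ₛ1-homo-*)

    ^ₛ≡^ : ∀ x k → x ^ₛ k ≡ x ^ k
    ^ₛ≡^ x zero = refl
    ^ₛ≡^ x (suc k) = cong (x *_) (^ₛ≡^ x k)

    p∣k⇒k×x≡0 : ∀ {k} x → p ∣ k → k ×ₛ x ≡ 0#
    p∣k⇒k×x≡0 x (divides d refl) = begin
      (d N.* p) ×ₛ x                   ≡⟨ cong ((d N.* p) ×ₛ_) (*-identityˡ x) ⟨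
      (d N.* p) ×ₛ (1# * x)            ≡⟨ ×-assoc-* (d N.* p) 1# x ⟨
      ((d N.* p) ×ₛ 1#) * x            ≡⟨ cong (_* x) (×ₛ1-homo-* d p) ⟩
      (d ×ₛ 1#) * (p ×ₛ 1#) * x        ≡⟨ cong (λ t → (d ×ₛ 1#) * t * x) (trans (×ᵤ≈× p 1#) p×1≡0) ⟩
      (d ×ₛ 1#) * 0# * x               ≡⟨ trans (cong (_* x) (zeroʳ _)) (zeroˡ x) ⟩
      0#                               ∎
      where open ≡-Reasoning

    binomial-endpoints : ∀ r → 1 < r → (∀ j → 0 < j → j < r → p ∣ r C j) →
      ∀ x y → (x + y) ^ r ≡ x ^ r + y ^ r
    binomial-endpoints (suc zero) (s≤s ())
    binomial-endpoints (suc (suc k)) _ p∣rCj x y = begin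
      (x + y) ^ r                     ≡⟨ ^ₛ≡^ (x + y) r ⟨
      (x + y) ^ₛ r                    ≡⟨ theorem r x y ⟩
      Σ+.sum h                        ≡⟨ sum-endpoints (suc k) h (λ i 0<i i<r → p∣k⇒k×x≡0 _ (p∣rCj (toℕ i) 0<i i<r)) ⟩
      h zero + h (fromℕ r)            ≡⟨ cong₂ _+_ h-first (h-last (toℕ (fromℕ r)) (Fin.toℕ-fromℕ r)) ⟩
      y ^ r + x ^ r                   ≡⟨ +-comm _ _ ⟩
      x ^ r + y ^ r                   ∎
      where
        open ≡-Reasoning
        r = suc (suc k)
        h : Fin (suc r) → Carrier
        h i = (r C toℕ i) ×ₛ (x ^ₛ toℕ i * y ^ₛ (r ∸ toℕ i))
        h-first : h zero ≡ y ^ r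
        h-first = trans (+-identityʳ _) (trans (*-identityˡ _) (^ₛ≡^ y r))
        h-last : ∀ j → j ≡ r → (r C j) ×ₛ (x ^ₛ j * y ^ₛ (r ∸ j)) ≡ x ^ r
        h-last j refl rewrite nCn≡1 r | N.n∸n≡0 r =
          trans (+-identityʳ _) (trans (*-identityʳ _) (^ₛ≡^ x r))

    frobenius : ∀ x y → (x + y) ^ p ≡ x ^ p + y ^ p
    frobenius = binomial-endpoints p 1<p p∣pCk

    frobenius-^ : ∀ k x y → (x + y) ^ (p N.^ k) ≡ x ^ (p N.^ k) + y ^ (p N.^ k)
    frobenius-^ zero x y = trans (*-identityʳ _) (sym (cong₂ _+_ (*-identityʳ x) (*-identityʳ y)))
    frobenius-^ (suc k) x y = begin
      (x + y) ^ (p N.* p N.^ k)                   ≡⟨ ^-*-assoc (x + y) p (p N.^ k) ⟨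
      ((x + y) ^ (p N.^ k)) ^ p                   ≡⟨ cong (_^ p) (frobenius-^ k x y) ⟩
      (x ^ (p N.^ k) + y ^ (p N.^ k)) ^ p         ≡⟨ frobenius _ _ ⟩
      (x ^ (p N.^ k)) ^ p + (y ^ (p N.^ k)) ^ p   ≡⟨ cong₂ _+_ (^-*-assoc x p (p N.^ k)) (^-*-assoc y p (p N.^ k)) ⟩
      x ^ (p N.* p N.^ k) + y ^ (p N.* p N.^ k)   ∎
      where open ≡-Reasoning

module Conjugation (p m : ℕ) (p-prime : Prime p) (p≢2 : p ≢ 2)
                   (F : FiniteField ((p N.^ m) N.* (p N.^ m))) where
  q : ℕ
  q = p N.^ m

  open Plane q F
  open FieldProperties F

  instance
    p≢0 : N.NonZero p
    p≢0 = prime⇒nonZero p-prime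

  p×1≡0 : p ×′ 1# ≡ 0#
  p×1≡0 = x^k≡0⇒x≡0 m (trans (sym (×′1-homo-^ p m)) (x*x≡0⇒x≡0 (trans (sym (×1-homo-* q q)) card×1≡0)))

  -- p = 2 (p / 2) + 1 in ℕ becomes 0 = 1 in F.
  2≢0 : 2 ×′ 1# ≢ 0#
  2≢0 2≡0 with p N.% 2 | N.m%n<n p 2 | N.m≡m%n+[m/n]*n p 2
  ... | 0 | _ | p≡[p/2]*2 = Prime.notComposite p-prime (composite-≢ 2 (p≢2 ∘ sym) (divides (p N./ 2) p≡[p/2]*2))
  ... | 1 | _ | p≡1+[p/2]*2 = 0≢1 (begin
      0#                            ≡⟨ p×1≡0 ⟨
      p ×′ 1#                       ≡⟨ cong (_×′ 1#) p≡1+[p/2]*2 ⟩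
      (1 N.+ p N./ 2 N.* 2) ×′ 1#   ≡⟨ ×-homo-+ 1# 1 (p N./ 2 N.* 2) ⟩
      1# + (p N./ 2 N.* 2) ×′ 1#    ≡⟨ cong (1# +_) (trans (×1-homo-* (p N./ 2) 2) (trans (cong ((p N./ 2) ×′ 1# *_) 2≡0) (zeroʳ _))) ⟩
      1# + 0#                       ≡⟨ +-identityʳ 1# ⟩
      1#                            ∎)
    where open ≡-Reasoning
  ... | suc (suc _) | s≤s (s≤s ()) | _

  open Frobenius p p-prime p×1≡0 using (frobenius-^)

  conj-+ : ∀ x y → conj (x + y) ≡ conj x + conj y
  conj-+ = frobenius-^ m

  conj-* : ∀ x y → conj (x * y) ≡ conj x * conj y
  conj-* x y = ^-distribʳ-* x y q

  conj-1 : conj 1# ≡ 1#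
  conj-1 = 1^k≡1 q

  conj-0 : conj 0# ≡ 0#
  conj-0 = 0^k≡0 q {{N.m^n≢0 p m}}

  conj-neg : ∀ x → conj (- x) ≡ - conj x
  conj-neg x = +-inverseˡ-unique _ _ (trans (sym (conj-+ (- x) x)) (trans (cong conj (-‿inverseˡ x)) conj-0))

  conj-sub : ∀ x y → conj (x - y) ≡ conj x - conj y
  conj-sub x y = trans (conj-+ x (- y)) (cong (conj x +_) (conj-neg y))

  conj-involutive : ∀ x → conj (conj x) ≡ x
  conj-involutive x = trans (^-*-assoc x q q) (x^card≡x x)

  conj-≢0 : ∀ {x} → x ≢ 0# → conj x ≢ 0#
  conj-≢0 = ^-≢0 q

  conj-⁻¹ : ∀ {x} → x ≢ 0# → conj (x ⁻¹) ≡ conj x ⁻¹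
  conj-⁻¹ {x} x≢0 = *-cancelˡ (conj-≢0 x≢0) (begin
      conj x * conj (x ⁻¹)   ≡⟨ conj-* x (x ⁻¹) ⟨
      conj (x * x ⁻¹)        ≡⟨ cong conj (⁻¹-inverse x x≢0) ⟩
      conj 1#                ≡⟨ conj-1 ⟩
      1#                     ≡⟨ ⁻¹-inverse (conj x) (conj-≢0 x≢0) ⟨
      conj x * conj x ⁻¹     ∎)
    where open ≡-Reasoning

  InGFq-×′1 : ∀ k → InGFq (k ×′ 1#)
  InGFq-×′1 zero = conj-0
  InGFq-×′1 (suc k) = begin
      conj (suc k ×′ 1#)     ≡⟨ cong conj (1+× k 1#) ⟩
      conj (1# + k ×′ 1#)    ≡⟨ conj-+ 1# (k ×′ 1#) ⟩
      conj 1# + conj (k ×′ 1#) ≡⟨ cong₂ _+_ conj-1 (InGFq-×′1 k) ⟩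
      1# + k ×′ 1#           ≡⟨ 1+× k 1# ⟨
      suc k ×′ 1#            ∎
    where open ≡-Reasoning

  InGFq-* : ∀ {x y} → InGFq x → InGFq y → InGFq (x * y)
  InGFq-* x̄≡x ȳ≡y = trans (conj-* _ _) (cong₂ _*_ x̄≡x ȳ≡y)

  InGFq-neg : ∀ {x} → InGFq x → InGFq (- x)
  InGFq-neg x̄≡x = trans (conj-neg _) (cong -_ x̄≡x)

  InGFq-sub : ∀ {x y} → InGFq x → InGFq y → InGFq (x - y)
  InGFq-sub x̄≡x ȳ≡y = trans (conj-sub _ _) (cong₂ _-_ x̄≡x ȳ≡y)

  InGFq-⁻¹ : ∀ {x} → x ≢ 0# → InGFq x → InGFq (x ⁻¹)
  InGFq-⁻¹ x≢0 x̄≡x = trans (conj-⁻¹ x≢0) (cong _⁻¹ x̄≡x)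

  InGFq-x+x̄ : ∀ x → InGFq (x + conj x)
  InGFq-x+x̄ x = trans (conj-+ x (conj x)) (trans (cong (conj x +_) (conj-involutive x)) (+-comm _ _))

  conj-x-x̄ : ∀ x → conj (x - conj x) ≡ - (x - conj x)
  conj-x-x̄ x = trans (conj-sub x (conj x)) (trans (cong (λ t → conj x - t) (conj-involutive x))
    (solve 2 (λ x x̄ → x̄ :- x := :- (x :- x̄)) refl x (conj x)))

  conj-anti : ∀ {x} → x ≡ - conj x → conj x ≡ - x
  conj-anti x≡-x̄ = trans (sym (-‿involutive _)) (cong -_ (sym x≡-x̄))

  anti*anti∈GFq : ∀ {x y} → conj x ≡ - x → conj y ≡ - y → InGFq (x * y)
  anti*anti∈GFq {x} {y} x̄≡-x ȳ≡-y = trans (conj-* x y) (trans (cong₂ _*_ x̄≡-x ȳ≡-y) (solve 2 (λ x y → :- x :* :- y := x :* y) refl x y))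

  conj-anti*GFq : ∀ {x y} → conj x ≡ - x → InGFq y → conj (x * y) ≡ - (x * y)
  conj-anti*GFq {x} {y} x̄≡-x ȳ≡y = trans (conj-* x y) (trans (cong₂ _*_ x̄≡-x ȳ≡y) (sym (-‿distribˡ-* x y)))

  -- ε² Δ δ c r is the discriminant of B¹(c,r) restricted to the line B²(δ,0) (discriminant≡ε²Δ).
  Δ : Carrier → Carrier → Carrier → Carrier
  Δ δ c r = (δ * conj c - conj δ * c) * (δ * conj c - conj δ * c) + four * δ * conj δ * (c * conj c - r)

  GFq : Set
  GFq = Σ Carrier λ x → True (conj x ≟ x)

  GFq* : Set
  GFq* = Σ Carrier λ x → True (conj x ≟ x ×-dec ¬? (x ≟ 0#))

  GFq↔⊤⊎GFq* : GFq ↔ (⊤ ⊎ GFq*)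
  GFq↔⊤⊎GFq* = mk↔ₛ′ to from to-from from-to
    where
      split : ∀ x → True (conj x ≟ x) → Dec (x ≡ 0#) → ⊤ ⊎ GFq*
      split x x̄≡x (yes _) = inj₁ tt
      split x x̄≡x (no x≢0) = inj₂ (x , fromWitness (toWitness x̄≡x , x≢0))
      to : GFq → ⊤ ⊎ GFq*
      to (x , x̄≡x) = split x x̄≡x (x ≟ 0#)
      from : ⊤ ⊎ GFq* → GFq
      from (inj₁ _) = 0# , fromWitness conj-0
      from (inj₂ (x , t)) = x , fromWitness (proj₁ (toWitness t))
      split-0 : ∀ t d → split 0# t d ≡ inj₁ tt
      split-0 t (yes _) = refl
      split-0 t (no 0≢0) = ⊥-elim (0≢0 refl)
      split-≢0 : ∀ x t t′ d → split x t′ d ≡ inj₂ (x , t)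
      split-≢0 x t t′ (yes x≡0) = ⊥-elim (proj₂ (toWitness t) x≡0)
      split-≢0 x t t′ (no _) = cong inj₂ (FiniteCounting.Σ-T-≡ _ refl)
      to-from : ∀ y → to (from y) ≡ y
      to-from (inj₁ tt) = split-0 _ (0# ≟ 0#)
      to-from (inj₂ (x , t)) = split-≢0 x t _ (x ≟ 0#)
      from-split : ∀ x t d → from (split x t d) ≡ (x , t)
      from-split x t (yes x≡0) = FiniteCounting.Σ-T-≡ _ (sym x≡0)
      from-split x t (no _) = FiniteCounting.Σ-T-≡ _ refl
      from-to : ∀ x → from (to x) ≡ x
      from-to (x , t) = from-split x t (x ≟ 0#)

  module Basis (ε : Carrier) (ε≢0 : ε ≢ 0#) (conj-ε : conj ε ≡ - ε) where

    half : Carrier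
    half = (2 ×′ 1#) ⁻¹

    half*2≡1 : half * 2 ×′ 1# ≡ 1#
    half*2≡1 = x⁻¹*x≡1 2≢0

    InGFq-half : InGFq half
    InGFq-half = trans (conj-⁻¹ 2≢0) (cong _⁻¹ (InGFq-×′1 2))

    conj-ε⁻¹ : conj (ε ⁻¹) ≡ - (ε ⁻¹)
    conj-ε⁻¹ = trans (conj-⁻¹ ε≢0) (trans (cong _⁻¹ conj-ε) (-‿⁻¹ ε≢0))

    re : Carrier → Carrier
    re x = (x + conj x) * half

    im : Carrier → Carrier
    im x = (x - conj x) * (ε ⁻¹ * half)

    InGFq-re : ∀ x → InGFq (re x)
    InGFq-re x = InGFq-* (InGFq-x+x̄ x) InGFq-half

    InGFq-im : ∀ x → InGFq (im x)
    InGFq-im x = anti*anti∈GFq (conj-x-x̄ x) (conj-anti*GFq conj-ε⁻¹ InGFq-half)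

    re+ε*im : ∀ x → re x + ε * im x ≡ x
    re+ε*im x = begin
      (x + conj x) * half + ε * ((x - conj x) * (ε ⁻¹ * half))
        ≡⟨ solve 5 (λ x x̄ h e u → (x :+ x̄) :* h :+ e :* ((x :- x̄) :* (u :* h))
                                   := h :* # 2 :* x :+ (e :* u :- # 1) :* h :* (x :- x̄)) refl x (conj x) half ε (ε ⁻¹) ⟩
      half * 2 ×′ 1# * x + (ε * ε ⁻¹ - 1#) * half * (x - conj x)
        ≡⟨ cong₂ (λ u v → u * x + v * half * (x - conj x)) half*2≡1 (x≈y⇒x∙y⁻¹≈ε (⁻¹-inverse ε ε≢0)) ⟩
      1# * x + 0# * half * (x - conj x)
        ≡⟨ solve 3 (λ x h d → # 1 :* x :+ # 0 :* h :* d := x) refl x half (x - conj x) ⟩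
      x ∎
      where open ≡-Reasoning

    module _ {a b : Carrier} (ā≡a : InGFq a) (b̄≡b : InGFq b) where

      conj-a+εb : conj (a + ε * b) ≡ a - ε * b
      conj-a+εb = trans (conj-+ _ _) (cong₂ _+_ ā≡a (conj-anti*GFq conj-ε b̄≡b))

      re-a+εb : re (a + ε * b) ≡ a
      re-a+εb = begin
        (a + ε * b + conj (a + ε * b)) * half ≡⟨ cong (λ t → (a + ε * b + t) * half) conj-a+εb ⟩
        (a + ε * b + (a - ε * b)) * half      ≡⟨ solve 4 (λ a b e h → (a :+ e :* b :+ (a :- e :* b)) :* h := h :* # 2 :* a) refl a b ε half ⟩
        half * 2 ×′ 1# * a                    ≡⟨ cong (_* a) half*2≡1 ⟩
        1# * a                                ≡⟨ *-identityˡ a ⟩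
        a                                     ∎
        where open ≡-Reasoning

      im-a+εb : im (a + ε * b) ≡ b
      im-a+εb = begin
        (a + ε * b - conj (a + ε * b)) * (ε ⁻¹ * half) ≡⟨ cong (λ t → (a + ε * b - t) * (ε ⁻¹ * half)) conj-a+εb ⟩
        (a + ε * b - (a - ε * b)) * (ε ⁻¹ * half)
          ≡⟨ solve 5 (λ a b e u h → (a :+ e :* b :- (a :- e :* b)) :* (u :* h) := (e :* u) :* (h :* # 2) :* b) refl a b ε (ε ⁻¹) half ⟩
        (ε * ε ⁻¹) * (half * 2 ×′ 1#) * b              ≡⟨ cong₂ (λ u v → u * v * b) (⁻¹-inverse ε ε≢0) half*2≡1 ⟩
        1# * 1# * b                                    ≡⟨ solve 1 (λ b → # 1 :* # 1 :* b := b) refl b ⟩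
        b                                              ∎
        where open ≡-Reasoning

    GF[q²]↔GFq×GFq : Carrier ↔ (GFq × GFq)
    GF[q²]↔GFq×GFq = mk↔ₛ′ to from to-from re+ε*im
      where
        to : Carrier → GFq × GFq
        to x = (re x , fromWitness (InGFq-re x)) , (im x , fromWitness (InGFq-im x))
        from : GFq × GFq → Carrier
        from ((a , _) , (b , _)) = a + ε * b
        to-from : ∀ y → to (from y) ≡ y
        to-from ((a , ā≡a) , (b , b̄≡b)) = cong₂ _,_
          (FiniteCounting.Σ-T-≡ _ (re-a+εb (toWitness ā≡a) (toWitness b̄≡b)))
          (FiniteCounting.Σ-T-≡ _ (im-a+εb (toWitness ā≡a) (toWitness b̄≡b)))

    GFq*-enumeration : Fin (q ∸ 1) ↔ GFq*
    GFq*-enumeration with FiniteCounting.count enumeration (λ x → isYes (conj x ≟ x ×-dec ¬? (x ≟ 0#)))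
    ... | ℓ , Fin-ℓ↔GFq* = subst (λ k → Fin k ↔ GFq*) (cong (_∸ 1) (sym q≡1+ℓ)) Fin-ℓ↔GFq*
      where
        Fin[1+ℓ]↔⊤⊎GFq* : Fin (suc ℓ) ↔ (⊤ ⊎ GFq*)
        Fin[1+ℓ]↔⊤⊎GFq* = (Fin.1↔⊤ ⊎-↔ Fin-ℓ↔GFq*) ↔-∘ Fin.+↔⊎ {1} {ℓ}
        square : Fin (q N.* q) ↔ Fin (suc ℓ N.* suc ℓ)
        square = ↔-sym Fin.*↔× ↔-∘ (↔-sym (Fin[1+ℓ]↔⊤⊎GFq* ×-↔ Fin[1+ℓ]↔⊤⊎GFq*) ↔-∘
                   ((GFq↔⊤⊎GFq* ×-↔ GFq↔⊤⊎GFq*) ↔-∘ (GF[q²]↔GFq×GFq ↔-∘ ↔-sym enumeration)))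
        q≡1+ℓ : q ≡ suc ℓ
        q≡1+ℓ = FiniteCounting.m*m≡n*n⇒m≡n (↔⇒≡ square)

    module TangencyToLine (δ : Carrier) (δ≢0 : δ ≢ 0#) where

      Line : PointSet
      Line = pts² δ 0#

      w : Carrier
      w = ε * δ

      w≢0 : w ≢ 0#
      w≢0 = *-≢0 ε≢0 δ≢0

      conj-w : conj w ≡ - ε * conj δ
      conj-w = trans (conj-* ε δ) (cong (_* conj δ) conj-ε)

      conj-s*w : ∀ {s} → InGFq s → conj (s * w) ≡ s * conj w
      conj-s*w {s} s̄≡s = trans (conj-* s w) (cong (_* conj w) s̄≡s)

      on-line : ∀ {s} → InGFq s → Line (just (s * w))
      on-line {s} s̄≡s = begin
        conj δ * (s * w) + δ * conj (s * w)                  ≡⟨ cong (λ t → conj δ * (s * w) + δ * t) (trans (conj-s*w s̄≡s) (cong (s *_) conj-w)) ⟩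
        conj δ * (s * (ε * δ)) + δ * (s * (- ε * conj δ))
          ≡⟨ solve 4 (λ δ̄ s e δ → δ̄ :* (s :* (e :* δ)) :+ δ :* (s :* (:- e :* δ̄)) := # 0) refl (conj δ) s ε δ ⟩
        0#                                                   ∎
        where open ≡-Reasoning

      -- z = (z / w) w, and z / w ∈ GF(q) because z̄ w = z w̄ on the line.
      line-parameter : ∀ {z} → Line (just z) → Σ Carrier λ s → InGFq s × z ≡ s * w
      line-parameter {z} z∈L = z * w ⁻¹ , s̄≡s , sym (trans (*-assoc _ _ _) (trans (cong (z *_) (x⁻¹*x≡1 w≢0)) (*-identityʳ z)))
        where
          open ≡-Reasoning
          z̄w≡zw̄ : conj z * w ≡ z * conj w
          z̄w≡zw̄ = x∙y⁻¹≈ε⇒x≈y _ _ (begin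
            conj z * w - z * conj w                    ≡⟨ cong (λ t → conj z * w - z * t) conj-w ⟩
            conj z * (ε * δ) - z * (- ε * conj δ)
              ≡⟨ solve 5 (λ z̄ z e δ δ̄ → z̄ :* (e :* δ) :- z :* (:- e :* δ̄) := e :* (δ̄ :* z :+ δ :* z̄)) refl (conj z) z ε δ (conj δ) ⟩
            ε * (conj δ * z + δ * conj z)              ≡⟨ cong (ε *_) z∈L ⟩
            ε * 0#                                     ≡⟨ zeroʳ ε ⟩
            0#                                         ∎)
          s̄≡s : conj (z * w ⁻¹) ≡ z * w ⁻¹
          s̄≡s = *-cancelʳ (*-≢0 w≢0 (conj-≢0 w≢0)) (begin
            conj (z * w ⁻¹) * (w * conj w)              ≡⟨ cong (_* (w * conj w)) (trans (conj-* z (w ⁻¹)) (cong (conj z *_) (conj-⁻¹ w≢0))) ⟩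
            conj z * conj w ⁻¹ * (w * conj w)
              ≡⟨ solve 4 (λ z̄ u w w̄ → z̄ :* u :* (w :* w̄) := (w̄ :* u) :* (z̄ :* w)) refl (conj z) (conj w ⁻¹) w (conj w) ⟩
            (conj w * conj w ⁻¹) * (conj z * w)         ≡⟨ cong₂ _*_ (⁻¹-inverse (conj w) (conj-≢0 w≢0)) z̄w≡zw̄ ⟩
            1# * (z * conj w)                           ≡⟨ cong (_* (z * conj w)) (x⁻¹*x≡1 w≢0) ⟨
            w ⁻¹ * w * (z * conj w)                     ≡⟨ solve 4 (λ u w z w̄ → u :* w :* (z :* w̄) := z :* u :* (w :* w̄)) refl (w ⁻¹) w z (conj w) ⟩
            z * w ⁻¹ * (w * conj w)                     ∎)

      a : Carrier
      a = w * conj w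

      a≢0 : a ≢ 0#
      a≢0 = *-≢0 w≢0 (conj-≢0 w≢0)

      InGFq-a : InGFq a
      InGFq-a = trans (conj-* w (conj w)) (trans (cong (conj w *_) (conj-involutive w)) (*-comm _ _))

      b : Carrier → Carrier
      b c = - (w * conj c + conj w * c)

      InGFq-b : ∀ c → InGFq (b c)
      InGFq-b c = trans (conj-neg _) (cong -_ (begin
        conj (w * conj c + conj w * c)                 ≡⟨ trans (conj-+ _ _) (cong₂ _+_ (conj-* _ _) (conj-* _ _)) ⟩
        conj w * conj (conj c) + conj (conj w) * conj c ≡⟨ cong₂ (λ u v → conj w * u + v * conj c) (conj-involutive c) (conj-involutive w) ⟩
        conj w * c + w * conj c                        ≡⟨ +-comm _ _ ⟩
        w * conj c + conj w * c                        ∎))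
        where open ≡-Reasoning

      module OnLine (c r : Carrier) = Quadratic a (b c) (c * conj c - r) a≢0

      circle-on-line : ∀ c r {s} → InGFq s → (s * w - c) * (conj (s * w) - conj c) - r ≡ OnLine.Q c r s
      circle-on-line c r {s} s̄≡s = trans (cong (λ t → (s * w - c) * (t - conj c) - r) (conj-s*w s̄≡s))
        (solve 6 (λ s w w̄ c c̄ r → (s :* w :- c) :* (s :* w̄ :- c̄) :- r
                    := w :* w̄ :* s :* s :+ (:- (w :* c̄ :+ w̄ :* c)) :* s :+ (c :* c̄ :- r)) refl s w (conj w) c (conj c) r)

      on-circle⇒root : ∀ {c r s} → InGFq s → pts¹ c r (just (s * w)) → OnLine.Q c r s ≡ 0#
      on-circle⇒root {c} {r} s̄≡s on-circle = trans (sym (circle-on-line c r s̄≡s)) (x≈y⇒x∙y⁻¹≈ε on-circle)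

      root⇒on-circle : ∀ {c r s} → InGFq s → OnLine.Q c r s ≡ 0# → pts¹ c r (just (s * w))
      root⇒on-circle {c} {r} s̄≡s Qs≡0 = x∙y⁻¹≈ε⇒x≈y _ _ (trans (circle-on-line c r s̄≡s) Qs≡0)

      discriminant≡ε²Δ : ∀ c r → OnLine.discriminant c r ≡ ε * ε * Δ δ c r
      discriminant≡ε²Δ c r = begin
        - (w * conj c + conj w * c) * - (w * conj c + conj w * c) - 4 ×′ 1# * (w * conj w) * (c * conj c - r)
          ≡⟨ cong (λ t → - (w * conj c + t * c) * - (w * conj c + t * c) - 4 ×′ 1# * (w * t) * (c * conj c - r)) conj-w ⟩
        - (w * conj c + - ε * conj δ * c) * - (w * conj c + - ε * conj δ * c) - 4 ×′ 1# * (w * (- ε * conj δ)) * (c * conj c - r)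
          ≡⟨ solve 6 (λ e δ δ̄ c c̄ r →
               :- (e :* δ :* c̄ :+ :- e :* δ̄ :* c) :* :- (e :* δ :* c̄ :+ :- e :* δ̄ :* c) :- # 4 :* (e :* δ :* (:- e :* δ̄)) :* (c :* c̄ :- r)
                 := e :* e :* ((δ :* c̄ :- δ̄ :* c) :* (δ :* c̄ :- δ̄ :* c) :+ # 4 :* δ :* δ̄ :* (c :* c̄ :- r))) refl ε δ (conj δ) c (conj c) r ⟩
        ε * ε * Δ δ c r ∎
        where open ≡-Reasoning

      ε²≢0 : ε * ε ≢ 0#
      ε²≢0 = *-≢0 ε≢0 ε≢0

      tangent⇒Δ≡0 : ∀ {c r} → Tangent (pts¹ c r) Line → Δ δ c r ≡ 0#
      tangent⇒Δ≡0 (_ , nothing , (() , _) , _)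
      tangent⇒Δ≡0 {c} {r} (_ , just z , (z∈C , z∈L) , unique) =
        x≢0⇒x*y≡0⇒y≡0 ε²≢0 (trans (sym (discriminant≡ε²Δ c r)) (otherRoot≡s⇒discriminant≡0 s Qs≡0 s′≡s))
        where
          open OnLine c r
          s = proj₁ (line-parameter z∈L)
          s̄≡s = proj₁ (proj₂ (line-parameter z∈L))
          z≡sw = proj₂ (proj₂ (line-parameter z∈L))
          Qs≡0 : Q s ≡ 0#
          Qs≡0 = on-circle⇒root s̄≡s (subst (pts¹ c r ∘ just) z≡sw z∈C)
          s′ = otherRoot s
          s̄′≡s′ : InGFq s′
          s̄′≡s′ = InGFq-sub (InGFq-neg (InGFq-* (InGFq-b c) (InGFq-⁻¹ a≢0 InGFq-a))) s̄≡s
          s′≡s : s′ ≡ s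
          s′≡s = *-cancelʳ w≢0 (trans (just-injective (unique _ (root⇒on-circle s̄′≡s′ (Q-otherRoot s Qs≡0)) (on-line s̄′≡s′))) z≡sw)

      vertex : Carrier → Carrier
      vertex c = - (b c * (2 ×′ 1# * a) ⁻¹)

      InGFq-vertex : ∀ c → InGFq (vertex c)
      InGFq-vertex c = InGFq-neg (InGFq-* (InGFq-b c) (InGFq-⁻¹ (*-≢0 2≢0 a≢0) (InGFq-* (InGFq-×′1 2) InGFq-a)))

      Δ≡0⇒discriminant≡0 : ∀ {c r} → Δ δ c r ≡ 0# → OnLine.discriminant c r ≡ 0#
      Δ≡0⇒discriminant≡0 {c} {r} Δ≡0 = trans (discriminant≡ε²Δ c r) (trans (cong (ε * ε *_) Δ≡0) (zeroʳ _))

      Δ≡0⇒common-point≡vertex : ∀ {c r} → Δ δ c r ≡ 0# → ∀ y → pts¹ c r y → Line y → y ≡ just (vertex c * w)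
      Δ≡0⇒common-point≡vertex Δ≡0 nothing () _
      Δ≡0⇒common-point≡vertex {c} {r} Δ≡0 (just z) z∈C z∈L = cong just (trans z≡sw (cong (_* w) s≡vertex))
        where
          s = proj₁ (line-parameter z∈L)
          s̄≡s = proj₁ (proj₂ (line-parameter z∈L))
          z≡sw = proj₂ (proj₂ (line-parameter z∈L))
          s≡vertex : s ≡ vertex c
          s≡vertex = OnLine.Vertex.discriminant≡0⇒root≡vertex c r 2≢0 (Δ≡0⇒discriminant≡0 Δ≡0)
                       (on-circle⇒root s̄≡s (subst (pts¹ c r ∘ just) z≡sw z∈C))

      Δ≡0⇒tangent : ∀ {c r} → Δ δ c r ≡ 0# → Tangent (pts¹ c r) Line
      Δ≡0⇒tangent {c} {r} Δ≡0 =
          (λ C≐L → Equivalence.from (C≐L nothing) tt)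
        , just (vertex c * w)
        , (root⇒on-circle (InGFq-vertex c) (OnLine.Vertex.discriminant≡0⇒Q-vertex≡0 c r 2≢0 (Δ≡0⇒discriminant≡0 Δ≡0))
          , on-line (InGFq-vertex c))
        , Δ≡0⇒common-point≡vertex Δ≡0

      w*c̄+w̄*c≡ε*[δ*c̄-δ̄*c] : ∀ c → w * conj c + conj w * c ≡ ε * (δ * conj c - conj δ * c)
      w*c̄+w̄*c≡ε*[δ*c̄-δ̄*c] c = trans (cong (λ t → w * conj c + t * c) conj-w)
        (solve 5 (λ e δ c̄ δ̄ c → e :* δ :* c̄ :+ :- e :* δ̄ :* c := e :* (δ :* c̄ :- δ̄ :* c)) refl ε δ (conj c) (conj δ) c)

      tangency-point-determines : ∀ {c r c′ r′} → Δ δ c r ≡ 0# → Δ δ c′ r′ ≡ 0# → pts¹ c r ≐ pts¹ c′ r′ →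
        δ * conj c - conj δ * c ≡ δ * conj c′ - conj δ * c′
      tangency-point-determines {c} {r} {c′} {r′} Δ≡0 Δ′≡0 C≐C′ = *-cancelˡ ε≢0 (begin
        ε * (δ * conj c - conj δ * c)       ≡⟨ w*c̄+w̄*c≡ε*[δ*c̄-δ̄*c] c ⟨
        w * conj c + conj w * c             ≡⟨ -‿injective (*-cancelʳ (⁻¹-≢0 (*-≢0 2≢0 a≢0)) (-‿injective vertex≡)) ⟩
        w * conj c′ + conj w * c′           ≡⟨ w*c̄+w̄*c≡ε*[δ*c̄-δ̄*c] c′ ⟩
        ε * (δ * conj c′ - conj δ * c′)     ∎)
        where
          open ≡-Reasoning
          P = just (vertex c * w)
          P∈C : pts¹ c r P
          P∈C = proj₁ (proj₁ (proj₂ (proj₂ (Δ≡0⇒tangent Δ≡0))))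
          vertex≡ : vertex c ≡ vertex c′
          vertex≡ = *-cancelʳ w≢0 (just-injective
            (Δ≡0⇒common-point≡vertex Δ′≡0 P (Equivalence.to (C≐C′ P) P∈C) (on-line (InGFq-vertex c))))

      just≢nothing : ∀ {z : Carrier} → just z ≢ nothing
      just≢nothing ()

      tangent-B²⇒c̄δ≡cδ̄ : ∀ {c r} → InGFq r → Tangent (pts² c r) Line → conj c * δ - c * conj δ ≡ 0#
      tangent-B²⇒c̄δ≡cδ̄ {c} {r} r̄≡r (_ , _ , _ , unique) =
        x≢0⇒x*y≡0⇒y≡0 ε≢0 (trans (sym A≡ε[c̄δ-cδ̄]) (decidable-stable (A ≟ 0#) A≢0-absurd))
        where
          open ≡-Reasoning
          A = conj c * w + c * conj w
          A≡ε[c̄δ-cδ̄] : A ≡ ε * (conj c * δ - c * conj δ)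
          A≡ε[c̄δ-cδ̄] = trans (cong (λ t → conj c * w + c * t) conj-w)
            (solve 5 (λ c̄ e δ c δ̄ → c̄ :* (e :* δ) :+ c :* (:- e :* δ̄) := e :* (c̄ :* δ :- c :* δ̄)) refl (conj c) ε δ c (conj δ))
          InGFq-A : InGFq A
          InGFq-A = trans (conj-+ _ _) (trans (cong₂ _+_ (trans (conj-* _ _) (cong (_* conj w) (conj-involutive c)))
                                                       (trans (conj-* _ _) (cong (conj c *_) (conj-involutive w)))) (+-comm _ _))
          -- Otherwise B² and the line would share both ∞ and the point (r / A) w.
          A≢0-absurd : ¬ (A ≢ 0#)
          A≢0-absurd A≢0 = just≢nothing (trans (unique _ s*w∈B² (on-line s̄≡s)) (sym (unique nothing tt tt)))
            where
              s = r * A ⁻¹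
              s̄≡s : InGFq s
              s̄≡s = InGFq-* r̄≡r (InGFq-⁻¹ A≢0 InGFq-A)
              s*w∈B² : pts² c r (just (s * w))
              s*w∈B² = begin
                conj c * (s * w) + c * conj (s * w)   ≡⟨ cong (λ t → conj c * (s * w) + c * t) (conj-s*w s̄≡s) ⟩
                conj c * (s * w) + c * (s * conj w)
                  ≡⟨ solve 5 (λ c̄ s w c w̄ → c̄ :* (s :* w) :+ c :* (s :* w̄) := s :* (c̄ :* w :+ c :* w̄)) refl (conj c) s w c (conj w) ⟩
                r * A ⁻¹ * A                          ≡⟨ trans (*-assoc _ _ _) (cong (r *_) (x⁻¹*x≡1 A≢0)) ⟩
                r * 1#                                ≡⟨ *-identityʳ r ⟩
                r                                     ∎

  module TangentToBothLines (γ : Carrier) (γ²≢γ̄² : γ * γ ≢ conj γ * conj γ) where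

    γ²-γ̄²≢0 : γ * γ - conj γ * conj γ ≢ 0#
    γ²-γ̄²≢0 = γ²≢γ̄² ∘ x∙y⁻¹≈ε⇒x≈y _ _

    γ²-γ̄²≡[γ+γ̄][γ-γ̄] : γ * γ - conj γ * conj γ ≡ (γ + conj γ) * (γ - conj γ)
    γ²-γ̄²≡[γ+γ̄][γ-γ̄] = solve 2 (λ g ḡ → g :* g :- ḡ :* ḡ := (g :+ ḡ) :* (g :- ḡ)) refl γ (conj γ)

    γ+γ̄≢0 : γ + conj γ ≢ 0#
    γ+γ̄≢0 γ+γ̄≡0 = γ²-γ̄²≢0 (trans γ²-γ̄²≡[γ+γ̄][γ-γ̄] (trans (cong (_* (γ - conj γ)) γ+γ̄≡0) (zeroˡ _)))

    ε : Carrier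
    ε = γ - conj γ

    ε≢0 : ε ≢ 0#
    ε≢0 γ-γ̄≡0 = γ²-γ̄²≢0 (trans γ²-γ̄²≡[γ+γ̄][γ-γ̄] (trans (cong ((γ + conj γ) *_) γ-γ̄≡0) (zeroʳ _)))

    γ≢0 : γ ≢ 0#
    γ≢0 γ≡0 = γ²≢γ̄² (trans (cong (λ t → t * t) γ≡0) (cong (λ t → t * t) (sym (trans (cong conj γ≡0) conj-0))))

    conj-ε : conj ε ≡ - ε
    conj-ε = conj-x-x̄ γ

    open Basis ε ε≢0 conj-ε

    module L₁ = TangencyToLine γ γ≢0
    module L₂ = TangencyToLine (conj γ) (conj-≢0 γ≢0)

    X : Carrier
    X = four * γ * conj γ

    X≢0 : X ≢ 0#
    X≢0 = *-≢0 (*-≢0 (*-≢0 2≢0 2≢0 ∘ trans (sym (×1-homo-* 2 2))) γ≢0) (conj-≢0 γ≢0)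

    Δ-conj-γ : ∀ c r → Δ (conj γ) c r ≡ (conj γ * conj c - γ * c) * (conj γ * conj c - γ * c) + four * conj γ * γ * (c * conj c - r)
    Δ-conj-γ c r = cong (λ g → (conj γ * conj c - g * c) * (conj γ * conj c - g * c) + four * conj γ * g * (c * conj c - r))
      (conj-involutive γ)

    Δ-difference : ∀ c r → Δ γ c r - Δ (conj γ) c r ≡ (γ * γ - conj γ * conj γ) * ((conj c + c) * (conj c - c))
    Δ-difference c r = trans (cong (λ t → Δ γ c r - t) (Δ-conj-γ c r)) (solve 5 (λ g ḡ c c̄ r →
        ((g :* c̄ :- ḡ :* c) :* (g :* c̄ :- ḡ :* c) :+ # 4 :* g :* ḡ :* (c :* c̄ :- r))
          :- ((ḡ :* c̄ :- g :* c) :* (ḡ :* c̄ :- g :* c) :+ # 4 :* ḡ :* g :* (c :* c̄ :- r))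
        := (g :* g :- ḡ :* ḡ) :* ((c̄ :+ c) :* (c̄ :- c))) refl γ (conj γ) c (conj c) r)

    Δγ≡Δγ̄⇔c̄²≡c² : ∀ c r → Δ γ c r ≡ Δ (conj γ) c r ⇔ (conj c + c) * (conj c - c) ≡ 0#
    Δγ≡Δγ̄⇔c̄²≡c² c r = mk⇔
      (λ Δ≡Δ′ → x≢0⇒x*y≡0⇒y≡0 γ²-γ̄²≢0 (trans (sym (Δ-difference c r)) (x≈y⇒x∙y⁻¹≈ε Δ≡Δ′)))
      (λ c̄²≡c² → x∙y⁻¹≈ε⇒x≈y _ _ (trans (Δ-difference c r) (trans (cong ((γ * γ - conj γ * conj γ) *_) c̄²≡c²) (zeroʳ _))))

    Δ-real : ∀ {c} r → conj c ≡ c → Δ γ c r ≡ c * c * ((γ + conj γ) * (γ + conj γ)) - X * r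
    Δ-real {c} r c̄≡c = trans (cong (λ t → (γ * t - conj γ * c) * (γ * t - conj γ * c) + four * γ * conj γ * (c * t - r)) c̄≡c)
      (solve 4 (λ g ḡ c r → (g :* c :- ḡ :* c) :* (g :* c :- ḡ :* c) :+ # 4 :* g :* ḡ :* (c :* c :- r)
                             := c :* c :* ((g :+ ḡ) :* (g :+ ḡ)) :- # 4 :* g :* ḡ :* r) refl γ (conj γ) c r)

    Δ-imaginary : ∀ {c} r → conj c ≡ - c → Δ γ c r ≡ c * c * ((γ - conj γ) * (γ - conj γ)) - X * r
    Δ-imaginary {c} r c̄≡-c = trans (cong (λ t → (γ * t - conj γ * c) * (γ * t - conj γ * c) + four * γ * conj γ * (c * t - r)) c̄≡-c)
      (solve 4 (λ g ḡ c r → (g :* :- c :- ḡ :* c) :* (g :* :- c :- ḡ :* c) :+ # 4 :* g :* ḡ :* (c :* :- c :- r)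
                             := c :* c :* ((g :- ḡ) :* (g :- ḡ)) :- # 4 :* g :* ḡ :* r) refl γ (conj γ) c r)

    goodParams⇒Δ≡0 : ∀ {c r} → GoodParams γ c r → Δ γ c r ≡ 0# × Δ (conj γ) c r ≡ 0#
    goodParams⇒Δ≡0 {c} {r} (_ , inj₁ (c≡c̄ , r≡r₊)) = Δγ≡0 , trans (sym Δγ≡Δγ̄) Δγ≡0
      where
        Δγ≡0 = trans (Δ-real r (sym c≡c̄)) (Equivalence.from (y-x*z≡0⇔z≡y*x⁻¹ X≢0) r≡r₊)
        Δγ≡Δγ̄ = Equivalence.from (Δγ≡Δγ̄⇔c̄²≡c² c r)
          (trans (cong ((conj c + c) *_) (x≈y⇒x∙y⁻¹≈ε (sym c≡c̄))) (zeroʳ _))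
    goodParams⇒Δ≡0 {c} {r} (_ , inj₂ (c≡-c̄ , r≡r₋)) = Δγ≡0 , trans (sym Δγ≡Δγ̄) Δγ≡0
      where
        c̄≡-c = conj-anti c≡-c̄
        Δγ≡0 = trans (Δ-imaginary r c̄≡-c) (Equivalence.from (y-x*z≡0⇔z≡y*x⁻¹ X≢0) r≡r₋)
        Δγ≡Δγ̄ = Equivalence.from (Δγ≡Δγ̄⇔c̄²≡c² c r)
          (trans (cong (_* (conj c - c)) (trans (cong (_+ c) c̄≡-c) (-‿inverseˡ c))) (zeroˡ _))

    Δ≡0⇒goodParams : ∀ {c r} → r ≢ 0# → Δ γ c r ≡ 0# → Δ (conj γ) c r ≡ 0# → GoodParams γ c r
    Δ≡0⇒goodParams {c} {r} r≢0 Δγ≡0 Δγ̄≡0 = c≢0 , real-or-imaginary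
      (x*y≡0⇒x≡0∨y≡0 _ _ (Equivalence.to (Δγ≡Δγ̄⇔c̄²≡c² c r) (trans Δγ≡0 (sym Δγ̄≡0))))
      where
        c≢0 : c ≢ 0#
        c≢0 refl = r≢0 (x≢0⇒x*y≡0⇒y≡0 X≢0 (-‿injective (trans (solve 2 (λ Y Xr → :- Xr := # 0 :* # 0 :* Y :- Xr) refl _ (X * r))
          (trans (sym (Δ-real r conj-0)) (trans Δγ≡0 (sym -0#≈0#))))))
        real-or-imaginary : conj c + c ≡ 0# ⊎ conj c - c ≡ 0# →
          (c ≡ conj c × r ≡ rPlus γ c) ⊎ (c ≡ - conj c × r ≡ rMinus γ c)
        real-or-imaginary (inj₂ c̄-c≡0) = inj₁ (sym c̄≡c , Equivalence.to (y-x*z≡0⇔z≡y*x⁻¹ X≢0) (trans (sym (Δ-real r c̄≡c)) Δγ≡0))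
          where c̄≡c = x∙y⁻¹≈ε⇒x≈y _ _ c̄-c≡0
        real-or-imaginary (inj₁ c̄+c≡0) = inj₂ (+-inverseˡ-unique c (conj c) (trans (+-comm _ _) c̄+c≡0) ,
          Equivalence.to (y-x*z≡0⇔z≡y*x⁻¹ X≢0) (trans (sym (Δ-imaginary r (+-inverseˡ-unique _ _ c̄+c≡0))) Δγ≡0))

    InGFq-X⁻¹ : InGFq (X ⁻¹)
    InGFq-X⁻¹ = InGFq-⁻¹ X≢0 (begin
      conj (four * γ * conj γ)               ≡⟨ trans (conj-* _ _) (cong (_* conj (conj γ)) (conj-* four γ)) ⟩
      conj four * conj γ * conj (conj γ)     ≡⟨ cong (λ t → t * conj γ * conj (conj γ)) (InGFq-×′1 4) ⟩
      four * conj γ * conj (conj γ)          ≡⟨ cong (four * conj γ *_) (conj-involutive γ) ⟩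
      four * conj γ * γ                      ≡⟨ solve 3 (λ f ḡ g → f :* ḡ :* g := f :* g :* ḡ) refl four (conj γ) γ ⟩
      four * γ * conj γ                      ∎)
      where open ≡-Reasoning

    goodParams⇒circle : ∀ {c r} → GoodParams γ c r → InGFq r × r ≢ 0#
    goodParams⇒circle {c} (c≢0 , inj₁ (c≡c̄ , refl)) =
        InGFq-* (InGFq-* (InGFq-* (sym c≡c̄) (sym c≡c̄)) (InGFq-* (InGFq-x+x̄ γ) (InGFq-x+x̄ γ))) InGFq-X⁻¹
      , *-≢0 (*-≢0 (*-≢0 c≢0 c≢0) (*-≢0 γ+γ̄≢0 γ+γ̄≢0)) (⁻¹-≢0 X≢0)
    goodParams⇒circle {c} (c≢0 , inj₂ (c≡-c̄ , refl)) =
        InGFq-* (InGFq-* (anti*anti∈GFq c̄≡-c c̄≡-c) (anti*anti∈GFq conj-ε conj-ε)) InGFq-X⁻¹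
      , *-≢0 (*-≢0 (*-≢0 c≢0 c≢0) (*-≢0 ε≢0 ε≢0)) (⁻¹-≢0 X≢0)
      where c̄≡-c = conj-anti c≡-c̄

    ≐-refl : ∀ {P : PointSet} → P ≐ P
    ≐-refl _ = mk⇔ (λ x → x) (λ x → x)

    ≐-trans : ∀ {P Q R : PointSet} → P ≐ Q → Q ≐ R → P ≐ R
    ≐-trans P≐Q Q≐R x = mk⇔ (Equivalence.to (Q≐R x) ∘ Equivalence.to (P≐Q x)) (Equivalence.from (P≐Q x) ∘ Equivalence.from (Q≐R x))

    ≐-sym : ∀ {P Q : PointSet} → P ≐ Q → Q ≐ P
    ≐-sym P≐Q x = mk⇔ (Equivalence.from (P≐Q x)) (Equivalence.to (P≐Q x))

    Tangent-respˡ-≐ : ∀ {P P′ Q : PointSet} → P ≐ P′ → Tangent P′ Q → Tangent P Q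
    Tangent-respˡ-≐ P≐P′ (P′≢Q , x , (x∈P′ , x∈Q) , unique) =
        (λ P≐Q → P′≢Q (≐-trans (≐-sym P≐P′) P≐Q))
      , x , (Equivalence.from (P≐P′ x) x∈P′ , x∈Q) , λ y y∈P y∈Q → unique y (Equivalence.to (P≐P′ y) y∈P) y∈Q

    tangentBoth⇒goodParams : ∀ C → TangentBoth γ C → ∃ λ c → ∃ λ r → GoodParams γ c r × (pts C ≐ pts¹ c r)
    tangentBoth⇒goodParams (B¹ c r _ r≢0) (tangent₁ , tangent₂) =
      c , r , Δ≡0⇒goodParams r≢0 (L₁.tangent⇒Δ≡0 tangent₁) (L₂.tangent⇒Δ≡0 tangent₂) , ≐-refl
    tangentBoth⇒goodParams (B² c r c≢0 r̄≡r) (tangent₁ , tangent₂) =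
      ⊥-elim (γ²-γ̄²≢0 (x≢0⇒x*y≡0⇒y≡0 (*-≢0 c≢0 (conj-≢0 c≢0)) (begin
        c * conj c * (γ * γ - conj γ * conj γ)
          ≡⟨ solve 4 (λ c c̄ g ḡ → c :* c̄ :* (g :* g :- ḡ :* ḡ) := c :* g :* (c̄ :* g :- c :* ḡ) :- c :* ḡ :* (c̄ :* ḡ :- c :* g)) refl c (conj c) γ (conj γ) ⟩
        c * γ * (conj c * γ - c * conj γ) - c * conj γ * (conj c * conj γ - c * γ)
          ≡⟨ cong₂ (λ u v → c * γ * u - c * conj γ * v) (L₁.tangent-B²⇒c̄δ≡cδ̄ r̄≡r tangent₁)
               (trans (cong (λ g → conj c * conj γ - c * g) (sym (conj-involutive γ))) (L₂.tangent-B²⇒c̄δ≡cδ̄ r̄≡r tangent₂)) ⟩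
        c * γ * 0# - c * conj γ * 0#
          ≡⟨ solve 2 (λ u v → u :* # 0 :- v :* # 0 := # 0) refl (c * γ) (c * conj γ) ⟩
        0# ∎)))
      where open ≡-Reasoning

    goodParams⇒tangentBoth : ∀ C → (∃ λ c → ∃ λ r → GoodParams γ c r × (pts C ≐ pts¹ c r)) → TangentBoth γ C
    goodParams⇒tangentBoth C (c , r , good , C≐B¹) =
        Tangent-respˡ-≐ C≐B¹ (L₁.Δ≡0⇒tangent (proj₁ (goodParams⇒Δ≡0 good)))
      , Tangent-respˡ-≐ C≐B¹ (L₂.Δ≡0⇒tangent (proj₂ (goodParams⇒Δ≡0 good)))

    goodParams-center-unique : ∀ {c r c′ r′} → GoodParams γ c r → GoodParams γ c′ r′ → pts¹ c r ≐ pts¹ c′ r′ → c ≡ c′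
    goodParams-center-unique {c} {r} {c′} {r′} good good′ C≐C′ =
      x∙y⁻¹≈ε⇒x≈y _ _ (x≢0⇒x*y≡0⇒y≡0 γ²-γ̄²≢0 (begin
        (γ * γ - conj γ * conj γ) * (c - c′)
          ≡⟨ solve 6 (λ g ḡ c c̄ c′ c̄′ → (g :* g :- ḡ :* ḡ) :* (c :- c′)
               := ḡ :* ((g :* c̄ :- ḡ :* c) :- (g :* c̄′ :- ḡ :* c′)) :- g :* ((ḡ :* c̄ :- g :* c) :- (ḡ :* c̄′ :- g :* c′)))
               refl γ (conj γ) c (conj c) c′ (conj c′) ⟩
        conj γ * ((γ * conj c - conj γ * c) - (γ * conj c′ - conj γ * c′))
          - γ * ((conj γ * conj c - γ * c) - (conj γ * conj c′ - γ * c′))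
          ≡⟨ cong₂ (λ u v → conj γ * u - γ * v) (x≈y⇒x∙y⁻¹≈ε same₁) (x≈y⇒x∙y⁻¹≈ε same₂) ⟩
        conj γ * 0# - γ * 0#
          ≡⟨ solve 2 (λ u v → u :* # 0 :- v :* # 0 := # 0) refl (conj γ) γ ⟩
        0# ∎))
      where
        open ≡-Reasoning
        same₁ = L₁.tangency-point-determines (proj₁ (goodParams⇒Δ≡0 good)) (proj₁ (goodParams⇒Δ≡0 good′)) C≐C′
        same₂ = subst (λ g → conj γ * conj c - g * c ≡ conj γ * conj c′ - g * c′) (conj-involutive γ)
          (L₂.tangency-point-determines (proj₂ (goodParams⇒Δ≡0 good)) (proj₂ (goodParams⇒Δ≡0 good′)) C≐C′)

    unit : Fin (q ∸ 1) → Carrier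
    unit j = proj₁ (Inverse.to GFq*-enumeration j)

    InGFq-unit : ∀ j → InGFq (unit j)
    InGFq-unit j = proj₁ (toWitness (proj₂ (Inverse.to GFq*-enumeration j)))

    unit-≢0 : ∀ j → unit j ≢ 0#
    unit-≢0 j = proj₂ (toWitness (proj₂ (Inverse.to GFq*-enumeration j)))

    unit-injective : ∀ {i j} → unit i ≡ unit j → i ≡ j
    unit-injective {i} {j} uᵢ≡uⱼ = Injection.injective (↔⇒↣ GFq*-enumeration) (FiniteCounting.Σ-T-≡ _ uᵢ≡uⱼ)

    unit-surjective : ∀ {x} → InGFq x → x ≢ 0# → ∃ λ j → unit j ≡ x
    unit-surjective {x} x̄≡x x≢0 = Inverse.from GFq*-enumeration (x , fromWitness (x̄≡x , x≢0))
      , cong proj₁ (Inverse.strictlyInverseˡ GFq*-enumeration _)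

    Index : Set
    Index = Fin (q ∸ 1) ⊎ Fin (q ∸ 1)

    center : Index → Carrier
    center (inj₁ j) = unit j
    center (inj₂ j) = ε * unit j

    radius : Index → Carrier
    radius (inj₁ j) = rPlus γ (unit j)
    radius (inj₂ j) = rMinus γ (ε * unit j)

    conj-ε*unit : ∀ j → conj (ε * unit j) ≡ - (ε * unit j)
    conj-ε*unit j = conj-anti*GFq conj-ε (InGFq-unit j)

    goodParams-index : ∀ s → GoodParams γ (center s) (radius s)
    goodParams-index (inj₁ j) = unit-≢0 j , inj₁ (sym (InGFq-unit j) , refl)
    goodParams-index (inj₂ j) = *-≢0 ε≢0 (unit-≢0 j) , inj₂ (sym (trans (cong -_ (conj-ε*unit j)) (-‿involutive _)) , refl)

    circle : Index → Circle
    circle s = B¹ (center s) (radius s) (proj₁ (goodParams⇒circle (goodParams-index s))) (proj₂ (goodParams⇒circle (goodParams-index s)))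

    unit≢ε*unit : ∀ {i j} → unit i ≢ ε * unit j
    unit≢ε*unit {i} {j} uᵢ≡εuⱼ = *-≢0 ε≢0 (unit-≢0 j) (x≡-x⇒x≡0 2≢0
      (trans (sym uᵢ≡εuⱼ) (trans (sym (InGFq-unit i)) (trans (cong conj uᵢ≡εuⱼ) (conj-ε*unit j)))))

    center-injective : ∀ {s s′} → center s ≡ center s′ → s ≡ s′
    center-injective {inj₁ i} {inj₁ j} uᵢ≡uⱼ = cong inj₁ (unit-injective uᵢ≡uⱼ)
    center-injective {inj₂ i} {inj₂ j} εuᵢ≡εuⱼ = cong inj₂ (unit-injective (*-cancelˡ ε≢0 εuᵢ≡εuⱼ))
    center-injective {inj₁ i} {inj₂ j} uᵢ≡εuⱼ = ⊥-elim (unit≢ε*unit uᵢ≡εuⱼ)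
    center-injective {inj₂ i} {inj₁ j} εuᵢ≡uⱼ = ⊥-elim (unit≢ε*unit (sym εuᵢ≡uⱼ))

    goodParams⇒index : ∀ {c r} → GoodParams γ c r → ∃ λ s → center s ≡ c × radius s ≡ r
    goodParams⇒index {c} (c≢0 , inj₁ (c≡c̄ , refl)) = inj₁ j , uⱼ≡c , cong (rPlus γ) uⱼ≡c
      where
        j = proj₁ (unit-surjective (sym c≡c̄) c≢0)
        uⱼ≡c = proj₂ (unit-surjective (sym c≡c̄) c≢0)
    goodParams⇒index {c} (c≢0 , inj₂ (c≡-c̄ , refl)) = inj₂ j , εuⱼ≡c , cong (rMinus γ) εuⱼ≡c
      where
        InGFq-c/ε : InGFq (c * ε ⁻¹)
        InGFq-c/ε = anti*anti∈GFq (conj-anti c≡-c̄) conj-ε⁻¹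
        found = unit-surjective InGFq-c/ε (*-≢0 c≢0 (⁻¹-≢0 ε≢0))
        j = proj₁ found
        εuⱼ≡c : ε * unit j ≡ c
        εuⱼ≡c = trans (cong (ε *_) (proj₂ found)) (x*[y*x⁻¹]≡y c ε≢0)

    Fin[2[q-1]]↔Index : Fin (2 N.* (q ∸ 1)) ↔ Index
    Fin[2[q-1]]↔Index = subst (λ l → Fin (2 N.* (q ∸ 1)) ↔ (Fin (q ∸ 1) ⊎ Fin l)) (N.+-identityʳ (q ∸ 1)) Fin.+↔⊎

    index : Fin (2 N.* (q ∸ 1)) → Index
    index = Inverse.to Fin[2[q-1]]↔Index

    tangentCircles : Vec Circle (2 N.* (q ∸ 1))
    tangentCircles = Vec.tabulate (circle ∘ index)

    lookup-tangentCircles : ∀ i → Vec.lookup tangentCircles i ≡ circle (index i)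
    lookup-tangentCircles = Vec.lookup∘tabulate (circle ∘ index)

    exactlyTangentBoth : ExactlyTangentBoth γ (2 N.* (q ∸ 1))
    exactlyTangentBoth = tangentCircles , tangent , distinct , complete
      where
        tangent : ∀ i → TangentBoth γ (Vec.lookup tangentCircles i)
        tangent i = subst (TangentBoth γ) (sym (lookup-tangentCircles i))
          (goodParams⇒tangentBoth (circle (index i)) (center (index i) , radius (index i) , goodParams-index (index i) , ≐-refl))
        distinct : ∀ i j → pts (Vec.lookup tangentCircles i) ≐ pts (Vec.lookup tangentCircles j) → i ≡ j
        distinct i j Cᵢ≐Cⱼ = Injection.injective (↔⇒↣ Fin[2[q-1]]↔Index) (center-injective
          (goodParams-center-unique (goodParams-index (index i)) (goodParams-index (index j))
            (subst₂ (λ C D → pts C ≐ pts D) (lookup-tangentCircles i) (lookup-tangentCircles j) Cᵢ≐Cⱼ)))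
        complete : ∀ C → TangentBoth γ C → ∃ λ i → pts C ≐ pts (Vec.lookup tangentCircles i)
        complete C tangentBoth = i , subst (λ D → pts C ≐ pts D) (sym lookupᵢ≡)
            (≐-trans C≐B¹ (subst₂ (λ c r → pts¹ c r ≐ pts¹ (center s) (radius s)) center≡ radius≡ ≐-refl))
          where
            params = tangentBoth⇒goodParams C tangentBoth
            C≐B¹ = proj₂ (proj₂ (proj₂ params))
            found = goodParams⇒index (proj₁ (proj₂ (proj₂ params)))
            s = proj₁ found
            center≡ = proj₁ (proj₂ found)
            radius≡ = proj₂ (proj₂ found)
            i = Inverse.from Fin[2[q-1]]↔Index s
            lookupᵢ≡ : Vec.lookup tangentCircles i ≡ circle s
            lookupᵢ≡ = trans (lookup-tangentCircles i) (cong circle (Inverse.strictlyInverseˡ Fin[2[q-1]]↔Index s))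

lemma4p2 : (p m : ℕ) → Prime p → ¬ (p ≡ 2) → 1 ≤ m →
    (F : FiniteField ((p N.^ m) N.* (p N.^ m))) →
    let open Plane (p N.^ m) F in
    (γ : Carrier) → ¬ (γ * γ ≡ conj γ * conj γ) →
      ExactlyTangentBoth γ (2 N.* ((p N.^ m) N.∸ 1))
    × (∀ c r → GoodParams γ c r → InGFq r × ¬ (r ≡ 0#))
    × (∀ C → TangentBoth γ C ⇔
         (∃ λ c → ∃ λ r → GoodParams γ c r × (pts C ≐ pts¹ c r)))
lemma4p2 p m p-prime p≢2 _ F γ γ²≢γ̄² =
  exactlyTangentBoth , (λ _ _ → goodParams⇒circle) , λ C → mk⇔ (tangentBoth⇒goodParams C) (goodParams⇒tangentBoth C)
  where open Conjugation.TangentToBothLines p m p-prime p≢2 F γ γ²≢γ̄²
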